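{- Let $k,m,M\in\mathbb{Z}_+$ with $k\le m\le M$ and let $\nu>0$. Let $A$ be a distribution on $\{0,1,\dots,m\}$ satisfying $|\mathbf{E}_{X\sim A}[\mathcal{K}_t(X;m)]|\le\nu$ for all $1\le t\le k$. Then for all $S,S'\subseteq[M]$ with $|S|=|S'|=m$, $$|\chi_{U_M}(\mathbf{P}^A_S,\mathbf{P}^A_{S'})|\le\Big(\frac{|S\cap S'|}{m}\Big)^{k+1}\chi^2(A,\mathrm{Bin}(m,1/2))+k\nu^2.$$
   Context: $U_M$ is the uniform distribution on $\{0,1\}^M$. For $k,x\in\{0,\dots,m\}$, the Kravchuk polynomial is $\mathcal{K}_k(x;m)=\sum_{j=0}^k(-1)^j\binom{x}{j}\binom{m-x}{k-j}$. For distributions $A,B$ on a finite set, $\chi^2(A,B)=\sum_x A(x)^2/B(x)-1$. For distributions $D_1,D_2$ on $\{0,1\}^M$, $\chi_{U_M}(D_1,D_2)=\sum_{\mathbf{x}\in\{0,1\}^M}D_1(\mathbf{x})D_2(\mathbf{x})/U_M(\mathbf{x})-1$. For $S\subseteq[M]$ with $|S|=m$, $\mathbf{P}^A_S$ is the distribution on $\{0,1\}^M$ with pmf $\mathbf{P}^A_S(\mathbf{x})=2^{ -M+m}A\big(\sum_{i\in S}x_i\big)\binom{m}{\sum_{i\in S}x_i}^{ -1}$.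
   Formalization: The probabilities of the distribution A and the bound ν take rational values. -}

module Defs where

open import Data.Nat using (ℕ; zero; suc; _∸_; _≤_)
import Data.Nat as ℕ
open import Data.Nat.Combinatorics using (_C_)
open import Data.Integer using (ℤ; +_; -[1+_])
import Data.Integer as ℤ
open import Data.Rational using (ℚ; _+_; _*_; _-_; 0ℚ; 1ℚ; _/_)
open import Data.List using (List; []; _∷_; map; foldr; upTo; concatMap; cartesianProductWith)
open import Data.Vec using (Vec; []; _∷_)
open import Data.Bool using (Bool; true; false)
open import Data.Fin.Subset using (Subset; _∩_; ∣_∣)

sumℚ : List ℚ → ℚ
sumℚ = foldr _+_ 0ℚ

-- Σ_{j=0}^{n} f j  (inclusive upper bound n).
Σ[0…_] : ℕ → (ℕ → ℚ) → ℚ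
Σ[0… n ] f = sumℚ (map f (upTo (suc n)))

ℤ→ℚ : ℤ → ℚ
ℤ→ℚ z = z / 1

ℕ→ℚ : ℕ → ℚ
ℕ→ℚ n = (+ n) / 1

_^ℚ_ : ℚ → ℕ → ℚ
q ^ℚ zero = 1ℚ
q ^ℚ suc n = q * (q ^ℚ n)

-- Division of a rational by a natural number.  All uses below divide by a
-- provably nonzero number; the value for division by 0 (namely 0) is a
-- convention that is never relevant.
_÷ℕ_ : ℚ → ℕ → ℚ
q ÷ℕ zero = 0ℚ
q ÷ℕ suc n = q * ((+ 1) / suc n)

-- Kravchuk polynomial  K_k(x;m) = Σ_{j=0}^k (-1)^j C(x,j) C(m-x,k-j)  (integer valued).
-- (Used for x ≤ m, so m ∸ x is the true difference.)
sumℤ : List ℤ → ℤ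
sumℤ = foldr ℤ._+_ (+ 0)

sign : ℕ → ℤ
sign zero = + 1
sign (suc zero) = -[1+ 0 ]
sign (suc (suc j)) = sign j

Kravchuk : (k x m : ℕ) → ℤ
Kravchuk k x m = sumℤ (map (λ j → sign j ℤ.* (+ ((x C j) ℕ.* ((m ∸ x) C (k ∸ j))))) (upTo (suc k)))

-- A distribution on {0,1,…,m}, given by its pmf A : ℕ → ℚ (values at x > m are
-- irrelevant and never used).
IsDistribution : (m : ℕ) → (ℕ → ℚ) → Set
IsDistribution m A = (∀ x → x ≤ m → 0ℚ Data.Rational.≤ A x) × (Σ[0… m ] A ≡ 1ℚ)
  where
    open import Data.Product using (_×_)
    open import Relation.Binary.PropositionalEquality using (_≡_)

EKravchuk : (m : ℕ) → (ℕ → ℚ) → ℕ → ℚ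
EKravchuk m A t = Σ[0… m ] (λ x → A x * ℤ→ℚ (Kravchuk t x m))

binHalf : ℕ → ℕ → ℚ
binHalf m x = ℕ→ℚ (m C x) ÷ℕ (2 ℕ.^ m)

-- χ²(A, Bin(m,1/2)) = Σ_{x=0}^m A(x)^2 / Bin(m,1/2)(x) - 1
--                   = Σ_{x=0}^m A(x)^2 · 2^m / C(m,x) - 1
chiSqBin : (m : ℕ) → (ℕ → ℚ) → ℚ
chiSqBin m A = Σ[0… m ] (λ x → (A x * A x * ℕ→ℚ (2 ℕ.^ m)) ÷ℕ (m C x)) - 1ℚ

-- All points of {0,1}^M (a point is a Bool vector = Subset M).
allPoints : (M : ℕ) → List (Subset M)
allPoints zero = [] ∷ []
allPoints (suc M) = concatMap (λ v → (true ∷ v) ∷ (false ∷ v) ∷ []) (allPoints M)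

P : (M m : ℕ) → (ℕ → ℚ) → Subset M → Subset M → ℚ
P M m A S x = A ∣ S ∩ x ∣ ÷ℕ ((2 ℕ.^ (M ∸ m)) ℕ.* (m C ∣ S ∩ x ∣))

chiU : (M : ℕ) → (Subset M → ℚ) → (Subset M → ℚ) → ℚ
chiU M D₁ D₂ = sumℚ (map (λ x → D₁ x * D₂ x * ℕ→ℚ (2 ℕ.^ M)) (allPoints M)) - 1ℚ

-- Expand in the characters χ_T(x) = (−1)^∣T ∩ x∣ of {0,1}^M. The density P^A_S depends on x only
-- through ∣S ∩ x∣, so its Fourier coefficient at T vanishes unless T ⊆ S and otherwise depends only
-- on t = ∣T∣ (it is coeff t below). Parseval therefore gives
--   χ_U(P^A_S, P^A_S′) = Σ_{t=1}^{ℓ} C(ℓ,t) coeff_t²,  where ℓ = ∣S ∩ S′∣,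
-- and, taking S = S′ = [m] inside {0,1}^m, χ²(A, Bin(m,1/2)) = Σ_{t=1}^{m} C(m,t) coeff_t²; the t = 0
-- terms equal 1 because A sums to 1. Moreover C(m,t) coeff_t = E_A[K_t(X;m)]. So for 1 ≤ t ≤ k the
-- t-th term of χ_U is at most C(m,t)² coeff_t² ≤ ν², while for t > k it is at most
-- (ℓ/m)^t C(m,t) coeff_t² ≤ (ℓ/m)^(k+1) C(m,t) coeff_t², since C(ℓ,t) m^t ≤ ℓ^t C(m,t).
module Submission where

open import Data.Nat.Base using (ℕ)
open import Data.Rational.Base using (ℚ)

module Binomial where

  open import Data.Nat
  open import Data.Nat.Properties
  open import Algebra.Properties.CommutativeSemigroup +-commutativeSemigroup using (interchange)
  open import Data.Nat.Combinatorics
  open import Data.Nat.DivMod using (m/n*n≡m)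
  open import Data.Nat.Tactic.RingSolver using (solve-∀)
  open import Relation.Binary.PropositionalEquality
  open import Relation.Nullary using (yes; no)

  C-pos : ∀ {n k} → k ≤ n → 1 ≤ n C k
  C-pos {k = zero} _ = ≤-refl
  C-pos {suc n} {suc k} (s≤s k≤n) =
    subst (1 ≤_) (nCk+nC[k+1]≡[n+1]C[k+1] n k) (≤-trans (C-pos k≤n) (m≤m+n _ _))

  C-monoˡ-≤ : ∀ {a b} k → a ≤ b → a C k ≤ b C k
  C-monoˡ-≤ {a} k a≤b = go (≤⇒≤′ a≤b)
    where
    C-≤-suc : ∀ n k → n C k ≤ suc n C k
    C-≤-suc n zero = ≤-refl
    C-≤-suc n (suc k) = subst (n C suc k ≤_) (nCk+nC[k+1]≡[n+1]C[k+1] n k) (m≤n+m _ _)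
    go : ∀ {b} → a ≤′ b → a C k ≤ b C k
    go ≤′-refl = ≤-refl
    go (≤′-step a≤′b) = ≤-trans (go a≤′b) (C-≤-suc _ k)

  C-factorial : ∀ a b → ((a + b) C a) * (a ! * b !) ≡ (a + b) !
  C-factorial a b = subst (λ c → ((a + b) C a) * (a ! * c !) ≡ (a + b) !) (m+n∸m≡n a b) (go (m≤m+n a b))
    where
    go : ∀ {n k} → k ≤ n → (n C k) * (k ! * (n ∸ k) !) ≡ n !
    go {n} {k} k≤n = trans (cong (_* (k ! * (n ∸ k) !)) (nCk≡n!/k![n-k]! k≤n)) (m/n*n≡m (k![n∸k]!∣n! k≤n))
      where instance _ = k !* (n ∸ k) !≢0

  -- Both sides equal the multinomial coefficient (i + p + l + q)! / (i! p! l! q!).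
  C-regroup : ∀ i p l q →
    (((i + p) + (l + q)) C (i + p)) * (((i + p) C i) * ((l + q) C l)) ≡
    (((i + p) + (l + q)) C (i + l)) * (((i + l) C i) * ((p + q) C p))
  C-regroup i p l q = *-cancelʳ-≡ _ _ (i ! * p ! * (l ! * q !)) {{m*n≢0 _ _ {{i !* p !≢0}} {{l !* q !≢0}}}}
    (trans via-ip-lq (sym via-il-pq))
    where
    N = (i + p) + (l + q)
    N≡ : N ≡ (i + l) + (p + q)
    N≡ = interchange i p l q
    via-ip-lq : (N C (i + p)) * (((i + p) C i) * ((l + q) C l)) * (i ! * p ! * (l ! * q !)) ≡ N !
    via-ip-lq = begin
      (N C (i + p)) * (((i + p) C i) * ((l + q) C l)) * (i ! * p ! * (l ! * q !))
        ≡⟨ shuffle (N C (i + p)) ((i + p) C i) ((l + q) C l) (i !) (p !) (l !) (q !) ⟩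
      (N C (i + p)) * ((((i + p) C i) * (i ! * p !)) * (((l + q) C l) * (l ! * q !)))
        ≡⟨ cong₂ (λ u v → (N C (i + p)) * (u * v)) (C-factorial i p) (C-factorial l q) ⟩
      (N C (i + p)) * ((i + p) ! * (l + q) !)
        ≡⟨ C-factorial (i + p) (l + q) ⟩
      N ! ∎
      where
      open ≡-Reasoning
      shuffle : ∀ a b c w x y z → a * (b * c) * (w * x * (y * z)) ≡ a * ((b * (w * x)) * (c * (y * z)))
      shuffle = solve-∀
    via-il-pq : (N C (i + l)) * (((i + l) C i) * ((p + q) C p)) * (i ! * p ! * (l ! * q !)) ≡ N !
    via-il-pq = begin
      (N C (i + l)) * (((i + l) C i) * ((p + q) C p)) * (i ! * p ! * (l ! * q !))
        ≡⟨ shuffle (N C (i + l)) ((i + l) C i) ((p + q) C p) (i !) (p !) (l !) (q !) ⟩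
      (N C (i + l)) * ((((i + l) C i) * (i ! * l !)) * (((p + q) C p) * (p ! * q !)))
        ≡⟨ cong₂ (λ u v → (N C (i + l)) * (u * v)) (C-factorial i l) (C-factorial p q) ⟩
      (N C (i + l)) * ((i + l) ! * (p + q) !)
        ≡⟨ cong (λ n → (n C (i + l)) * ((i + l) ! * (p + q) !)) N≡ ⟩
      (((i + l) + (p + q)) C (i + l)) * ((i + l) ! * (p + q) !)
        ≡⟨ C-factorial (i + l) (p + q) ⟩
      ((i + l) + (p + q)) !
        ≡⟨ cong _! N≡ ⟨
      N ! ∎
      where
      open ≡-Reasoning
      shuffle : ∀ a b c w x y z → a * (b * c) * (w * x * (y * z)) ≡ a * ((b * (w * y)) * (c * (x * z)))
      shuffle = solve-∀

  -- Both sides count pairs (T, X) of subsets of an m-set with ∣T∣ = t, ∣X∣ = i + l and ∣T ∩ X∣ = i.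
  C-choose-twice : ∀ {m t i l} → i ≤ t → t ≤ m → l ≤ m ∸ t →
    (m C t) * ((t C i) * ((m ∸ t) C l)) ≡ (m C (i + l)) * (((i + l) C i) * ((m ∸ (i + l)) C (t ∸ i)))
  C-choose-twice {m} {t} {i} {l} i≤t t≤m l≤m∸t =
    go (t ∸ i) ((m ∸ t) ∸ l) (m+[n∸m]≡n i≤t)
       (trans (cong (t +_) (m+[n∸m]≡n l≤m∸t)) (m+[n∸m]≡n t≤m))
    where
    go : ∀ {m t} p q → i + p ≡ t → t + (l + q) ≡ m →
      (m C t) * ((t C i) * ((m ∸ t) C l)) ≡ (m C (i + l)) * (((i + l) C i) * ((m ∸ (i + l)) C (t ∸ i)))
    go p q refl refl =
      trans (cong (λ r → (((i + p) + (l + q)) C (i + p)) * (((i + p) C i) * (r C l))) (m+n∸m≡n (i + p) (l + q)))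
        (trans (C-regroup i p l q)
          (cong₂ (λ r s → (((i + p) + (l + q)) C (i + l)) * (((i + l) C i) * (r C s))) (sym rest) (sym (m+n∸m≡n i p))))
      where
      rest : (i + p) + (l + q) ∸ (i + l) ≡ p + q
      rest = trans (cong (_∸ (i + l)) (interchange i p l q)) (m+n∸m≡n (i + l) (p + q))

  C-absorption : ∀ n s → (n C suc s) * suc s ≡ (n C s) * (n ∸ s)
  C-absorption n s with s <? n
  ... | yes s<n = go (n ∸ suc s) (m+[n∸m]≡n s<n)
    where
    go : ∀ {n} r → suc s + r ≡ n → (n C suc s) * suc s ≡ (n C s) * (n ∸ s)
    go r refl = *-cancelʳ-≡ _ _ (s ! * r !) {{s !* r !≢0}} (begin
      ((suc s + r) C suc s) * suc s * (s ! * r !) ≡⟨ shuffleˡ ((suc s + r) C suc s) s (s !) (r !) ⟩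
      ((suc s + r) C suc s) * (suc s ! * r !) ≡⟨ C-factorial (suc s) r ⟩
      (suc s + r) ! ≡⟨ cong _! (+-suc s r) ⟨
      (s + suc r) ! ≡⟨ C-factorial s (suc r) ⟨
      ((s + suc r) C s) * (s ! * suc r !) ≡⟨ cong (λ n → (n C s) * (s ! * suc r !)) (+-suc s r) ⟩
      ((suc s + r) C s) * (s ! * suc r !) ≡⟨ shuffleʳ ((suc s + r) C s) r (s !) (r !) ⟨
      ((suc s + r) C s) * suc r * (s ! * r !) ≡⟨ cong (λ d → ((suc s + r) C s) * d * (s ! * r !)) [s+1+r]∸s≡1+r ⟨
      ((suc s + r) C s) * (suc s + r ∸ s) * (s ! * r !) ∎)
      where
      open ≡-Reasoning
      shuffleˡ : ∀ c s f g → c * suc s * (f * g) ≡ c * ((suc s * f) * g)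
      shuffleˡ = solve-∀
      shuffleʳ : ∀ c r f g → c * suc r * (f * g) ≡ c * (f * (suc r * g))
      shuffleʳ = solve-∀
      [s+1+r]∸s≡1+r : suc s + r ∸ s ≡ suc r
      [s+1+r]∸s≡1+r = trans (cong (_∸ s) (sym (+-suc s r))) (m+n∸m≡n s (suc r))
  ... | no s≮n = begin
    (n C suc s) * suc s ≡⟨ cong (_* suc s) (k>n⇒nCk≡0 (s≤s n≤s)) ⟩
    0 ≡⟨ *-zeroʳ (n C s) ⟨
    (n C s) * 0 ≡⟨ cong ((n C s) *_) (m≤n⇒m∸n≡0 n≤s) ⟨
    (n C s) * (n ∸ s) ∎
    where
    open ≡-Reasoning
    n≤s = ≮⇒≥ s≮n

  C-ratio-bound : ∀ {ℓ m} s → ℓ ≤ m → (ℓ C s) * m ^ s ≤ ℓ ^ s * (m C s)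
  C-ratio-bound zero _ = ≤-refl
  C-ratio-bound {ℓ} {m} (suc s) ℓ≤m = *-cancelʳ-≤ _ _ (suc s) (begin
    (ℓ C suc s) * (m * m ^ s) * suc s ≡⟨ shuffle₁ (ℓ C suc s) m (m ^ s) (suc s) ⟩
    ((ℓ C suc s) * suc s) * (m * m ^ s) ≡⟨ cong (_* (m * m ^ s)) (C-absorption ℓ s) ⟩
    ((ℓ C s) * (ℓ ∸ s)) * (m * m ^ s) ≡⟨ shuffle₂ (ℓ C s) (ℓ ∸ s) m (m ^ s) ⟩
    ((ℓ C s) * m ^ s) * ((ℓ ∸ s) * m) ≤⟨ *-mono-≤ (C-ratio-bound s ℓ≤m) [ℓ∸s]m≤[m∸s]ℓ ⟩
    (ℓ ^ s * (m C s)) * ((m ∸ s) * ℓ) ≡⟨ shuffle₃ (ℓ ^ s) (m C s) (m ∸ s) ℓ ⟩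
    (ℓ * ℓ ^ s) * ((m C s) * (m ∸ s)) ≡⟨ cong ((ℓ * ℓ ^ s) *_) (C-absorption m s) ⟨
    (ℓ * ℓ ^ s) * ((m C suc s) * suc s) ≡⟨ *-assoc (ℓ * ℓ ^ s) (m C suc s) (suc s) ⟨
    (ℓ * ℓ ^ s) * (m C suc s) * suc s ∎)
    where
    open ≤-Reasoning
    shuffle₁ : ∀ a b c d → a * (b * c) * d ≡ (a * d) * (b * c)
    shuffle₁ = solve-∀
    shuffle₂ : ∀ a b c d → (a * b) * (c * d) ≡ (a * d) * (b * c)
    shuffle₂ = solve-∀
    shuffle₃ : ∀ a b c d → (a * b) * (c * d) ≡ (d * a) * (b * c)
    shuffle₃ = solve-∀
    [ℓ∸s]m≤[m∸s]ℓ : (ℓ ∸ s) * m ≤ (m ∸ s) * ℓ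
    [ℓ∸s]m≤[m∸s]ℓ = begin
      (ℓ ∸ s) * m ≡⟨ *-distribʳ-∸ m ℓ s ⟩
      ℓ * m ∸ s * m ≤⟨ ∸-monoʳ-≤ (ℓ * m) (*-monoʳ-≤ s ℓ≤m) ⟩
      ℓ * m ∸ s * ℓ ≡⟨ cong (_∸ s * ℓ) (*-comm ℓ m) ⟩
      m * ℓ ∸ s * ℓ ≡⟨ *-distribʳ-∸ ℓ m s ⟨
      (m ∸ s) * ℓ ∎

module RationalArithmetic where

  open import Defs
  open import Data.Integer as ℤ using (+_)
  import Data.Integer.Properties as ℤₚ
  open import Relation.Nullary.Decidable using (dec⇒maybe)
  open import Data.Nat as ℕ using (ℕ; zero; suc; z≤n; s≤s)
  import Data.Nat.Properties as ℕₚ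
  open import Data.Rational
  open import Data.Rational.Properties
  import Data.Rational.Unnormalised as ℚᵘ
  import Data.Rational.Unnormalised.Properties as ℚᵘₚ
  open import Data.Sum using (inj₁; inj₂)
  open import Relation.Binary.PropositionalEquality
  open import Tactic.RingSolver using (solve-∀)
  import Tactic.RingSolver.Core.AlmostCommutativeRing as ACR

  ℚ-ring : ACR.AlmostCommutativeRing _ _
  ℚ-ring = ACR.fromCommutativeRing +-*-commutativeRing (λ x → dec⇒maybe (0ℚ ≟ x))

  fromℚᵘ-+ : ∀ p q → fromℚᵘ (p ℚᵘ.+ q) ≡ fromℚᵘ p + fromℚᵘ q
  fromℚᵘ-+ p q = toℚᵘ-injective (ℚᵘₚ.≃-trans (toℚᵘ-fromℚᵘ (p ℚᵘ.+ q))
    (ℚᵘₚ.≃-sym (ℚᵘₚ.≃-trans (toℚᵘ-homo-+ (fromℚᵘ p) (fromℚᵘ q))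
      (ℚᵘₚ.+-cong (toℚᵘ-fromℚᵘ p) (toℚᵘ-fromℚᵘ q)))))

  fromℚᵘ-* : ∀ p q → fromℚᵘ (p ℚᵘ.* q) ≡ fromℚᵘ p * fromℚᵘ q
  fromℚᵘ-* p q = toℚᵘ-injective (ℚᵘₚ.≃-trans (toℚᵘ-fromℚᵘ (p ℚᵘ.* q))
    (ℚᵘₚ.≃-sym (ℚᵘₚ.≃-trans (toℚᵘ-homo-* (fromℚᵘ p) (fromℚᵘ q))
      (ℚᵘₚ.*-cong (toℚᵘ-fromℚᵘ p) (toℚᵘ-fromℚᵘ q)))))

  ℤ→ℚ-+ : ∀ a b → ℤ→ℚ (a ℤ.+ b) ≡ ℤ→ℚ a + ℤ→ℚ b
  ℤ→ℚ-+ a b = trans (fromℚᵘ-cong {ℚᵘ.mkℚᵘ (a ℤ.+ b) 0} {ℚᵘ.mkℚᵘ a 0 ℚᵘ.+ ℚᵘ.mkℚᵘ b 0} (ℚᵘ.*≡* cross))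
    (fromℚᵘ-+ (ℚᵘ.mkℚᵘ a 0) (ℚᵘ.mkℚᵘ b 0))
    where
    cross : (a ℤ.+ b) ℤ.* + 1 ≡ (a ℤ.* + 1 ℤ.+ b ℤ.* + 1) ℤ.* + 1
    cross = cong (ℤ._* + 1) (sym (cong₂ ℤ._+_ (ℤₚ.*-identityʳ a) (ℤₚ.*-identityʳ b)))

  ℤ→ℚ-* : ∀ a b → ℤ→ℚ (a ℤ.* b) ≡ ℤ→ℚ a * ℤ→ℚ b
  ℤ→ℚ-* a b = fromℚᵘ-* (ℚᵘ.mkℚᵘ a 0) (ℚᵘ.mkℚᵘ b 0)

  ℕ→ℚ-+ : ∀ a b → ℕ→ℚ (a ℕ.+ b) ≡ ℕ→ℚ a + ℕ→ℚ b
  ℕ→ℚ-+ a b = trans (cong ℤ→ℚ (ℤₚ.pos-+ a b)) (ℤ→ℚ-+ (+ a) (+ b))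

  ℕ→ℚ-* : ∀ a b → ℕ→ℚ (a ℕ.* b) ≡ ℕ→ℚ a * ℕ→ℚ b
  ℕ→ℚ-* a b = trans (cong ℤ→ℚ (ℤₚ.pos-* a b)) (ℤ→ℚ-* (+ a) (+ b))

  ℕ→ℚ-^ : ∀ a s → ℕ→ℚ (a ℕ.^ s) ≡ ℕ→ℚ a ^ℚ s
  ℕ→ℚ-^ a zero = refl
  ℕ→ℚ-^ a (suc s) = trans (ℕ→ℚ-* a (a ℕ.^ s)) (cong (ℕ→ℚ a *_) (ℕ→ℚ-^ a s))

  ℕ→ℚ-mono-≤ : ∀ {a b} → a ℕ.≤ b → ℕ→ℚ a ≤ ℕ→ℚ b
  ℕ→ℚ-mono-≤ {a} {b} a≤b = toℚᵘ-cancel-≤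
    (ℚᵘₚ.≤-respˡ-≃ (ℚᵘₚ.≃-sym (toℚᵘ-fromℚᵘ (ℚᵘ.mkℚᵘ (+ a) 0)))
    (ℚᵘₚ.≤-respʳ-≃ (ℚᵘₚ.≃-sym (toℚᵘ-fromℚᵘ (ℚᵘ.mkℚᵘ (+ b) 0)))
      (ℚᵘ.*≤* (ℤₚ.*-monoʳ-≤-nonNeg (+ 1) (ℤ.+≤+ a≤b)))))

  ℕ→ℚ-nonNeg : ∀ a → 0ℚ ≤ ℕ→ℚ a
  ℕ→ℚ-nonNeg a = ℕ→ℚ-mono-≤ {0} {a} z≤n

  *-monoˡ-≤-0≤ : ∀ {r p q} → 0ℚ ≤ r → p ≤ q → r * p ≤ r * q
  *-monoˡ-≤-0≤ {r} 0≤r = *-monoˡ-≤-nonNeg r {{nonNegative 0≤r}}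

  *-monoʳ-≤-0≤ : ∀ {r p q} → 0ℚ ≤ r → p ≤ q → p * r ≤ q * r
  *-monoʳ-≤-0≤ {r} 0≤r = *-monoʳ-≤-nonNeg r {{nonNegative 0≤r}}

  *-nonNeg : ∀ {p q} → 0ℚ ≤ p → 0ℚ ≤ q → 0ℚ ≤ p * q
  *-nonNeg {p} {q} 0≤p 0≤q = subst (_≤ p * q) (*-zeroʳ p) (*-monoˡ-≤-0≤ 0≤p 0≤q)

  square-nonNeg : ∀ p → 0ℚ ≤ p * p
  square-nonNeg p with ≤-total 0ℚ p
  ... | inj₁ 0≤p = *-nonNeg 0≤p 0≤p
  ... | inj₂ p≤0 = subst (0ℚ ≤_) (neg*neg p) (*-nonNeg (neg-antimono-≤ p≤0) (neg-antimono-≤ p≤0))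
    where neg*neg : ∀ p → - p * - p ≡ p * p
          neg*neg = solve-∀ ℚ-ring

  ∣p∣≤q⇒p*p≤q*q : ∀ {p q} → ∣ p ∣ ≤ q → p * p ≤ q * q
  ∣p∣≤q⇒p*p≤q*q {p} {q} ∣p∣≤q = begin
    p * p ≡⟨ 0≤p⇒∣p∣≡p (square-nonNeg p) ⟨
    ∣ p * p ∣ ≡⟨ ∣p*q∣≡∣p∣*∣q∣ p p ⟩
    ∣ p ∣ * ∣ p ∣ ≤⟨ *-monoʳ-≤-0≤ (0≤∣p∣ p) ∣p∣≤q ⟩
    q * ∣ p ∣ ≤⟨ *-monoˡ-≤-0≤ (≤-trans (0≤∣p∣ p) ∣p∣≤q) ∣p∣≤q ⟩
    q * q ∎
    where open ≤-Reasoning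

  ^ℚ-distrib-* : ∀ p q s → (p * q) ^ℚ s ≡ p ^ℚ s * q ^ℚ s
  ^ℚ-distrib-* p q zero = refl
  ^ℚ-distrib-* p q (suc s) = trans (cong ((p * q) *_) (^ℚ-distrib-* p q s)) (interchange p q (p ^ℚ s) (q ^ℚ s))
    where interchange : ∀ a b c d → (a * b) * (c * d) ≡ (a * c) * (b * d)
          interchange = solve-∀ ℚ-ring

  1^ℚ : ∀ s → 1ℚ ^ℚ s ≡ 1ℚ
  1^ℚ zero = refl
  1^ℚ (suc s) = trans (*-identityˡ (1ℚ ^ℚ s)) (1^ℚ s)

  ^ℚ-nonNeg : ∀ {p} s → 0ℚ ≤ p → 0ℚ ≤ p ^ℚ s
  ^ℚ-nonNeg zero _ = ℕ→ℚ-nonNeg 1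
  ^ℚ-nonNeg (suc s) 0≤p = *-nonNeg 0≤p (^ℚ-nonNeg s 0≤p)

  ^ℚ-antimono : ∀ {r} → 0ℚ ≤ r → r ≤ 1ℚ → ∀ a d → r ^ℚ (a ℕ.+ d) ≤ r ^ℚ a
  ^ℚ-antimono {r} _ _ a zero = ≤-reflexive (cong (r ^ℚ_) (ℕₚ.+-identityʳ a))
  ^ℚ-antimono {r} 0≤r r≤1 a (suc d) = begin
    r ^ℚ (a ℕ.+ suc d) ≡⟨ cong (r ^ℚ_) (ℕₚ.+-suc a d) ⟩
    r * r ^ℚ (a ℕ.+ d) ≤⟨ *-monoʳ-≤-0≤ (^ℚ-nonNeg (a ℕ.+ d) 0≤r) r≤1 ⟩
    1ℚ * r ^ℚ (a ℕ.+ d) ≡⟨ *-identityˡ _ ⟩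
    r ^ℚ (a ℕ.+ d) ≤⟨ ^ℚ-antimono 0≤r r≤1 a d ⟩
    r ^ℚ a ∎
    where open ≤-Reasoning

  ÷ℕ-as-* : ∀ q n → q ÷ℕ n ≡ q * (1ℚ ÷ℕ n)
  ÷ℕ-as-* q zero = sym (*-zeroʳ q)
  ÷ℕ-as-* q (suc n) = cong (q *_) (sym (*-identityˡ ((+ 1) / suc n)))

  1÷ℕ-nonNeg : ∀ n → 0ℚ ≤ 1ℚ ÷ℕ n
  1÷ℕ-nonNeg zero = ≤-refl
  1÷ℕ-nonNeg (suc n) = *-nonNeg (ℕ→ℚ-nonNeg 1) (nonNegative⁻¹ ((+ 1) / suc n) {{normalize-nonNeg 1 (suc n)}})

  ℕ→ℚ*1÷ℕ≡1 : ∀ {n} → 1 ℕ.≤ n → ℕ→ℚ n * (1ℚ ÷ℕ n) ≡ 1ℚ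
  ℕ→ℚ*1÷ℕ≡1 {suc n} _ = trans (cong (ℕ→ℚ (suc n) *_) (*-identityˡ ((+ 1) / suc n)))
    (trans (*-comm (ℕ→ℚ (suc n)) ((+ 1) / suc n))
      (trans (sym (fromℚᵘ-* (ℚᵘ.mkℚᵘ (+ 1) n) (ℚᵘ.mkℚᵘ (+ suc n) 0)))
        (fromℚᵘ-cong {ℚᵘ.mkℚᵘ (+ 1) n ℚᵘ.* ℚᵘ.mkℚᵘ (+ suc n) 0} {ℚᵘ.mkℚᵘ (+ 1) 0} (ℚᵘ.*≡* cross))))
    where
    cross : (+ 1 ℤ.* + suc n) ℤ.* + 1 ≡ + 1 ℤ.* + (suc n ℕ.* 1)
    cross = trans (ℤₚ.*-identityʳ _) (trans (ℤₚ.*-identityˡ _)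
      (sym (trans (ℤₚ.*-identityˡ _) (cong +_ (ℕₚ.*-identityʳ (suc n))))))

  *-÷ℕ-cancel : ∀ {n} q → 1 ℕ.≤ n → ℕ→ℚ n * (q ÷ℕ n) ≡ q
  *-÷ℕ-cancel {n} q 1≤n = begin
    ℕ→ℚ n * (q ÷ℕ n) ≡⟨ cong (ℕ→ℚ n *_) (÷ℕ-as-* q n) ⟩
    ℕ→ℚ n * (q * (1ℚ ÷ℕ n)) ≡⟨ x*[y*z]≡y*[x*z] (ℕ→ℚ n) q (1ℚ ÷ℕ n) ⟩
    q * (ℕ→ℚ n * (1ℚ ÷ℕ n)) ≡⟨ cong (q *_) (ℕ→ℚ*1÷ℕ≡1 1≤n) ⟩
    q * 1ℚ ≡⟨ *-identityʳ q ⟩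
    q ∎
    where
    open ≡-Reasoning
    x*[y*z]≡y*[x*z] : ∀ x y z → x * (y * z) ≡ y * (x * z)
    x*[y*z]≡y*[x*z] = solve-∀ ℚ-ring

  1÷ℕ-* : ∀ a b → 1ℚ ÷ℕ (a ℕ.* b) ≡ (1ℚ ÷ℕ a) * (1ℚ ÷ℕ b)
  1÷ℕ-* zero b = sym (*-zeroˡ (1ℚ ÷ℕ b))
  1÷ℕ-* (suc a) zero = trans (cong (1ℚ ÷ℕ_) (ℕₚ.*-zeroʳ (suc a))) (sym (*-zeroʳ (1ℚ ÷ℕ suc a)))
  1÷ℕ-* a@(suc _) b@(suc _) = begin
    x ≡⟨ x≡x*[1*1] x ⟩
    x * (1ℚ * 1ℚ) ≡⟨ cong (x *_) (sym (cong₂ _*_ (ℕ→ℚ*1÷ℕ≡1 {a} (s≤s z≤n)) (ℕ→ℚ*1÷ℕ≡1 {b} (s≤s z≤n)))) ⟩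
    x * ((ℕ→ℚ a * 1÷a) * (ℕ→ℚ b * 1÷b)) ≡⟨ regroup x (ℕ→ℚ a) (ℕ→ℚ b) 1÷a 1÷b ⟩
    ((ℕ→ℚ a * ℕ→ℚ b) * x) * (1÷a * 1÷b) ≡⟨ cong (λ y → (y * x) * (1÷a * 1÷b)) (ℕ→ℚ-* a b) ⟨
    (ℕ→ℚ (a ℕ.* b) * x) * (1÷a * 1÷b)
      ≡⟨ cong (_* (1÷a * 1÷b)) (ℕ→ℚ*1÷ℕ≡1 {a ℕ.* b} (ℕₚ.*-mono-≤ {1} {a} {1} {b} (s≤s z≤n) (s≤s z≤n))) ⟩
    1ℚ * (1÷a * 1÷b) ≡⟨ *-identityˡ _ ⟩
    1÷a * 1÷b ∎
    where
    open ≡-Reasoning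
    x = 1ℚ ÷ℕ (a ℕ.* b)
    1÷a = 1ℚ ÷ℕ a
    1÷b = 1ℚ ÷ℕ b
    x≡x*[1*1] : ∀ x → x ≡ x * (1ℚ * 1ℚ)
    x≡x*[1*1] = solve-∀ ℚ-ring
    regroup : ∀ x p q u v → x * ((p * u) * (q * v)) ≡ ((p * q) * x) * (u * v)
    regroup = solve-∀ ℚ-ring

  ÷ℕ-*-cancelˡ : ∀ q {a} n → 1 ℕ.≤ a → ℕ→ℚ a * (q ÷ℕ (a ℕ.* n)) ≡ q ÷ℕ n
  ÷ℕ-*-cancelˡ q {a} n 1≤a = begin
    ℕ→ℚ a * (q ÷ℕ (a ℕ.* n)) ≡⟨ cong (ℕ→ℚ a *_) (trans (÷ℕ-as-* q (a ℕ.* n)) (cong (q *_) (1÷ℕ-* a n))) ⟩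
    ℕ→ℚ a * (q * ((1ℚ ÷ℕ a) * (1ℚ ÷ℕ n))) ≡⟨ regroup (ℕ→ℚ a) q (1ℚ ÷ℕ a) (1ℚ ÷ℕ n) ⟩
    (ℕ→ℚ a * (1ℚ ÷ℕ a)) * (q * (1ℚ ÷ℕ n)) ≡⟨ cong (_* (q * (1ℚ ÷ℕ n))) (ℕ→ℚ*1÷ℕ≡1 1≤a) ⟩
    1ℚ * (q * (1ℚ ÷ℕ n)) ≡⟨ *-identityˡ _ ⟩
    q * (1ℚ ÷ℕ n) ≡⟨ ÷ℕ-as-* q n ⟨
    q ÷ℕ n ∎
    where
    open ≡-Reasoning
    regroup : ∀ p q u v → p * (q * (u * v)) ≡ (p * u) * (q * v)
    regroup = solve-∀ ℚ-ring

  0≤ℓ÷ℕm : ∀ ℓ m → 0ℚ ≤ ℕ→ℚ ℓ ÷ℕ m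
  0≤ℓ÷ℕm ℓ m = subst (0ℚ ≤_) (sym (÷ℕ-as-* (ℕ→ℚ ℓ) m)) (*-nonNeg (ℕ→ℚ-nonNeg ℓ) (1÷ℕ-nonNeg m))

  ℓ÷ℕm≤1 : ∀ {ℓ m} → ℓ ℕ.≤ m → 1 ℕ.≤ m → ℕ→ℚ ℓ ÷ℕ m ≤ 1ℚ
  ℓ÷ℕm≤1 {ℓ} {m} ℓ≤m 1≤m = subst₂ _≤_ (sym (÷ℕ-as-* (ℕ→ℚ ℓ) m)) (ℕ→ℚ*1÷ℕ≡1 1≤m)
    (*-monoʳ-≤-0≤ (1÷ℕ-nonNeg m) (ℕ→ℚ-mono-≤ ℓ≤m))

module FiniteSums where

  open RationalArithmetic
  open import Defs
  open import Data.List using (map; applyUpTo)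
  open import Data.Nat as ℕ using (ℕ; zero; suc; z≤n; s≤s; _∸_)
  import Data.Nat.Properties as ℕₚ
  open import Data.Nat.Combinatorics using (_C_; nCk+nC[k+1]≡[n+1]C[k+1]; k>n⇒nCk≡0)
  open import Data.Rational
  open import Data.Rational.Properties
  open import Relation.Binary.PropositionalEquality
  open import Tactic.RingSolver using (solve-∀)
  open Binomial using (C-ratio-bound)

  ∑ : ℕ → (ℕ → ℚ) → ℚ
  ∑ zero f = 0ℚ
  ∑ (suc n) f = f 0 + ∑ n (λ i → f (suc i))

  syntax ∑ n (λ i → e) = ∑[ i < n ] e

  Σ[0…]≡∑ : ∀ n f → Σ[0… n ] f ≡ ∑ (suc n) f
  Σ[0…]≡∑ n f = go (suc n) (λ i → i)
    where
    go : ∀ n (g : ℕ → ℕ) → sumℚ (map f (applyUpTo g n)) ≡ ∑[ i < n ] f (g i)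
    go zero g = refl
    go (suc n) g = cong (f (g 0) +_) (go n (λ i → g (suc i)))

  ∑-cong< : ∀ n {f g : ℕ → ℚ} → (∀ i → i ℕ.< n → f i ≡ g i) → ∑ n f ≡ ∑ n g
  ∑-cong< zero _ = refl
  ∑-cong< (suc n) f≡g = cong₂ _+_ (f≡g 0 (s≤s z≤n)) (∑-cong< n (λ i i<n → f≡g (suc i) (s≤s i<n)))

  ∑-cong : ∀ n {f g : ℕ → ℚ} → (∀ i → f i ≡ g i) → ∑ n f ≡ ∑ n g
  ∑-cong n f≡g = ∑-cong< n (λ i _ → f≡g i)

  ∑-+ : ∀ n (f g : ℕ → ℚ) → ∑[ i < n ] (f i + g i) ≡ ∑ n f + ∑ n g
  ∑-+ zero _ _ = refl
  ∑-+ (suc n) f g = trans (cong (f 0 + g 0 +_) (∑-+ n _ _)) (interchange (f 0) (g 0) _ _)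
    where interchange : ∀ a b c d → a + b + (c + d) ≡ a + c + (b + d)
          interchange = solve-∀ ℚ-ring

  ∑-*ˡ : ∀ n c (f : ℕ → ℚ) → ∑[ i < n ] (c * f i) ≡ c * ∑ n f
  ∑-*ˡ zero c _ = sym (*-zeroʳ c)
  ∑-*ˡ (suc n) c f = trans (cong (c * f 0 +_) (∑-*ˡ n c _)) (sym (*-distribˡ-+ c (f 0) _))

  ∑-const : ∀ n c → ∑ n (λ _ → c) ≡ ℕ→ℚ n * c
  ∑-const zero c = sym (*-zeroˡ c)
  ∑-const (suc n) c = trans (cong (c +_) (∑-const n c)) (trans (factor c (ℕ→ℚ n)) (cong (_* c) (sym (ℕ→ℚ-+ 1 n))))
    where factor : ∀ c x → c + x * c ≡ (1ℚ + x) * c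
          factor = solve-∀ ℚ-ring

  ∑-zero : ∀ n {f : ℕ → ℚ} → (∀ i → i ℕ.< n → f i ≡ 0ℚ) → ∑ n f ≡ 0ℚ
  ∑-zero n f≡0 = trans (∑-cong< n f≡0) (trans (∑-const n 0ℚ) (*-zeroʳ (ℕ→ℚ n)))

  ∑-split : ∀ a b (f : ℕ → ℚ) → ∑ (a ℕ.+ b) f ≡ ∑ a f + ∑[ l < b ] f (a ℕ.+ l)
  ∑-split zero b f = sym (+-identityˡ _)
  ∑-split (suc a) b f = trans (cong (f 0 +_) (∑-split a b _)) (sym (+-assoc (f 0) _ _))

  ∑-last : ∀ n (f : ℕ → ℚ) → ∑ (suc n) f ≡ ∑ n f + f n
  ∑-last n f = begin
    ∑ (suc n) f ≡⟨ cong (λ k → ∑ k f) (ℕₚ.+-comm 1 n) ⟩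
    ∑ (n ℕ.+ 1) f ≡⟨ ∑-split n 1 f ⟩
    ∑ n f + (f (n ℕ.+ 0) + 0ℚ) ≡⟨ cong (λ x → ∑ n f + x) (trans (+-identityʳ _) (cong f (ℕₚ.+-identityʳ n))) ⟩
    ∑ n f + f n ∎
    where open ≡-Reasoning

  ∑-extend : ∀ n d (f : ℕ → ℚ) → (∀ e → e ℕ.< d → f (n ℕ.+ e) ≡ 0ℚ) → ∑ (n ℕ.+ d) f ≡ ∑ n f
  ∑-extend n d f tail≡0 = trans (∑-split n d f) (trans (cong (∑ n f +_) (∑-zero d tail≡0)) (+-identityʳ _))

  ∑-drop : ∀ a n (f : ℕ → ℚ) → (∀ i → i ℕ.< a → f i ≡ 0ℚ) → ∑ (a ℕ.+ n) f ≡ ∑[ l < n ] f (a ℕ.+ l)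
  ∑-drop a n f head≡0 = trans (∑-split a n f) (trans (cong (_+ ∑[ l < n ] f (a ℕ.+ l)) (∑-zero a head≡0)) (+-identityˡ _))

  ∑-swap : ∀ a b (F : ℕ → ℕ → ℚ) → ∑[ i < a ] ∑[ j < b ] F i j ≡ ∑[ j < b ] ∑[ i < a ] F i j
  ∑-swap zero b F = sym (∑-zero b (λ _ _ → refl))
  ∑-swap (suc a) b F = trans (cong (∑ b (F 0) +_) (∑-swap a b (λ i → F (suc i))))
    (sym (∑-+ b (F 0) (λ j → ∑[ i < a ] F (suc i) j)))

  ∑-mono-≤ : ∀ n {f g : ℕ → ℚ} → (∀ i → i ℕ.< n → f i ≤ g i) → ∑ n f ≤ ∑ n g
  ∑-mono-≤ zero _ = ≤-refl
  ∑-mono-≤ (suc n) f≤g = +-mono-≤ (f≤g 0 (s≤s z≤n)) (∑-mono-≤ n (λ i i<n → f≤g (suc i) (s≤s i<n)))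

  ∑-nonNeg : ∀ n {f : ℕ → ℚ} → (∀ i → 0ℚ ≤ f i) → 0ℚ ≤ ∑ n f
  ∑-nonNeg n {f} 0≤f = subst (_≤ ∑ n f) (∑-zero n {λ _ → 0ℚ} (λ _ _ → refl)) (∑-mono-≤ n (λ i _ → 0≤f i))

  ∑-split-bound : ∀ {k n ρ c} {f g : ℕ → ℚ} → k ℕ.≤ n → 0ℚ ≤ ρ → (∀ i → 0ℚ ≤ g i) →
    (∀ i → i ℕ.< k → f i ≤ c) → (∀ i → k ℕ.≤ i → f i ≤ ρ * g i) →
    ∑ n f ≤ ρ * ∑ n g + ℕ→ℚ k * c
  ∑-split-bound {k} {n} {ρ} {c} {f} {g} k≤n 0≤ρ 0≤g low high = begin
    ∑ n f ≡⟨ cong (λ j → ∑ j f) n≡k+[n∸k] ⟩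
    ∑ (k ℕ.+ (n ∸ k)) f ≡⟨ ∑-split k (n ∸ k) f ⟩
    ∑ k f + ∑[ e < n ∸ k ] f (k ℕ.+ e)
      ≤⟨ +-mono-≤ (∑-mono-≤ k (λ i i<k → ≤-trans (low i i<k) c≤ρg+c))
                  (∑-mono-≤ (n ∸ k) (λ e _ → high (k ℕ.+ e) (ℕₚ.m≤m+n k e))) ⟩
    ∑[ i < k ] (ρ * g i + c) + ∑[ e < n ∸ k ] (ρ * g (k ℕ.+ e))
      ≡⟨ cong₂ _+_ (trans (∑-+ k _ _) (cong₂ _+_ (∑-*ˡ k ρ g) (∑-const k c))) (∑-*ˡ (n ∸ k) ρ _) ⟩
    ρ * ∑ k g + ℕ→ℚ k * c + ρ * ∑[ e < n ∸ k ] g (k ℕ.+ e)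
      ≡⟨ regroup ρ (∑ k g) (∑[ e < n ∸ k ] g (k ℕ.+ e)) (ℕ→ℚ k * c) ⟩
    ρ * (∑ k g + ∑[ e < n ∸ k ] g (k ℕ.+ e)) + ℕ→ℚ k * c
      ≡⟨ cong (λ x → ρ * x + ℕ→ℚ k * c) (trans (sym (∑-split k (n ∸ k) g)) (cong (λ j → ∑ j g) (sym n≡k+[n∸k]))) ⟩
    ρ * ∑ n g + ℕ→ℚ k * c ∎
    where
    open ≤-Reasoning
    n≡k+[n∸k] : n ≡ k ℕ.+ (n ∸ k)
    n≡k+[n∸k] = sym (ℕₚ.m+[n∸m]≡n k≤n)
    c≤ρg+c : ∀ {i} → c ≤ ρ * g i + c
    c≤ρg+c {i} = subst (_≤ ρ * g i + c) (+-identityˡ c) (+-monoˡ-≤ c (*-nonNeg 0≤ρ (0≤g i)))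
    regroup : ∀ ρ x y z → ρ * x + z + ρ * y ≡ ρ * (x + y) + z
    regroup = solve-∀ ℚ-ring

  _Cℚ_ : ℕ → ℕ → ℚ
  n Cℚ k = ℕ→ℚ (n C k)

  Cℚ-ratio-bound : ∀ {ℓ m} s → ℓ ℕ.≤ m → 1 ℕ.≤ m → ℓ Cℚ s ≤ (ℕ→ℚ ℓ ÷ℕ m) ^ℚ s * m Cℚ s
  Cℚ-ratio-bound {ℓ} {m} s ℓ≤m 1≤m = begin
    ℓ Cℚ s
      ≡⟨ sym (trans (cong (λ x → ℓ Cℚ s * x ^ℚ s) (ℕ→ℚ*1÷ℕ≡1 1≤m)) (trans (cong (ℓ Cℚ s *_) (1^ℚ s)) (*-identityʳ _))) ⟩
    ℓ Cℚ s * (ℕ→ℚ m * 1÷m) ^ℚ s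
      ≡⟨ trans (cong (ℓ Cℚ s *_) (^ℚ-distrib-* (ℕ→ℚ m) 1÷m s)) (sym (*-assoc (ℓ Cℚ s) _ _)) ⟩
    ℓ Cℚ s * ℕ→ℚ m ^ℚ s * 1÷m ^ℚ s
      ≡⟨ cong (_* 1÷m ^ℚ s) (trans (cong (ℓ Cℚ s *_) (sym (ℕ→ℚ-^ m s))) (sym (ℕ→ℚ-* (ℓ C s) (m ℕ.^ s)))) ⟩
    ℕ→ℚ ((ℓ C s) ℕ.* m ℕ.^ s) * 1÷m ^ℚ s
      ≤⟨ *-monoʳ-≤-0≤ (^ℚ-nonNeg s (1÷ℕ-nonNeg m)) (ℕ→ℚ-mono-≤ (C-ratio-bound s ℓ≤m)) ⟩
    ℕ→ℚ (ℓ ℕ.^ s ℕ.* (m C s)) * 1÷m ^ℚ s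
      ≡⟨ cong (_* 1÷m ^ℚ s) (trans (ℕ→ℚ-* (ℓ ℕ.^ s) (m C s)) (cong (_* m Cℚ s) (ℕ→ℚ-^ ℓ s))) ⟩
    ℕ→ℚ ℓ ^ℚ s * m Cℚ s * 1÷m ^ℚ s
      ≡⟨ x*y*z≡x*z*y (ℕ→ℚ ℓ ^ℚ s) (m Cℚ s) (1÷m ^ℚ s) ⟩
    ℕ→ℚ ℓ ^ℚ s * 1÷m ^ℚ s * m Cℚ s
      ≡⟨ cong (_* m Cℚ s) (trans (sym (^ℚ-distrib-* (ℕ→ℚ ℓ) 1÷m s)) (cong (_^ℚ s) (sym (÷ℕ-as-* (ℕ→ℚ ℓ) m)))) ⟩
    (ℕ→ℚ ℓ ÷ℕ m) ^ℚ s * m Cℚ s ∎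
    where
    open ≤-Reasoning
    1÷m = 1ℚ ÷ℕ m
    x*y*z≡x*z*y : ∀ x y z → x * y * z ≡ x * z * y
    x*y*z≡x*z*y = solve-∀ ℚ-ring

  binomialSum : ℕ → (ℕ → ℚ) → ℚ
  binomialSum n ψ = ∑[ j < suc n ] (n Cℚ j * ψ j)

  binomialSum-cong : ∀ n {ψ χ : ℕ → ℚ} → (∀ j → ψ j ≡ χ j) → binomialSum n ψ ≡ binomialSum n χ
  binomialSum-cong n ψ≡χ = ∑-cong (suc n) (λ j → cong (n Cℚ j *_) (ψ≡χ j))

  binomialSum-+ : ∀ n (ψ χ : ℕ → ℚ) → binomialSum n (λ j → ψ j + χ j) ≡ binomialSum n ψ + binomialSum n χ
  binomialSum-+ n ψ χ = trans (∑-cong (suc n) (λ j → *-distribˡ-+ (n Cℚ j) (ψ j) (χ j)))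
    (∑-+ (suc n) (λ j → n Cℚ j * ψ j) (λ j → n Cℚ j * χ j))

  binomialSum-*ˡ : ∀ n c (ψ : ℕ → ℚ) → binomialSum n (λ j → c * ψ j) ≡ c * binomialSum n ψ
  binomialSum-*ˡ n c ψ = trans (∑-cong (suc n) (λ j → x*[y*z]≡y*[x*z] (n Cℚ j) c (ψ j))) (∑-*ˡ (suc n) c (λ j → n Cℚ j * ψ j))
    where x*[y*z]≡y*[x*z] : ∀ x y z → x * (y * z) ≡ y * (x * z)
          x*[y*z]≡y*[x*z] = solve-∀ ℚ-ring

  binomialSum-suc : ∀ n (ψ : ℕ → ℚ) → binomialSum (suc n) ψ ≡ binomialSum n ψ + binomialSum n (λ j → ψ (suc j))
  binomialSum-suc n ψ = begin
    1ℚ * ψ 0 + ∑[ i < suc n ] (suc n Cℚ suc i * ψ (suc i))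
      ≡⟨ cong (1ℚ * ψ 0 +_) (trans (∑-cong (suc n) pascal) (∑-+ (suc n) (λ i → n Cℚ i * ψ (suc i)) (λ i → n Cℚ suc i * ψ (suc i)))) ⟩
    1ℚ * ψ 0 + (∑[ i < suc n ] (n Cℚ i * ψ (suc i)) + ∑[ i < suc n ] (n Cℚ suc i * ψ (suc i)))
      ≡⟨ cong (λ x → 1ℚ * ψ 0 + (∑[ i < suc n ] (n Cℚ i * ψ (suc i)) + x)) (∑-last n _) ⟩
    1ℚ * ψ 0 + (∑[ i < suc n ] (n Cℚ i * ψ (suc i)) + (∑[ i < n ] (n Cℚ suc i * ψ (suc i)) + n Cℚ suc n * ψ (suc n)))
      ≡⟨ cong (λ c → 1ℚ * ψ 0 + (∑[ i < suc n ] (n Cℚ i * ψ (suc i)) + (∑[ i < n ] (n Cℚ suc i * ψ (suc i)) + ℕ→ℚ c * ψ (suc n))))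
              (k>n⇒nCk≡0 (ℕₚ.n<1+n n)) ⟩
    1ℚ * ψ 0 + (∑[ i < suc n ] (n Cℚ i * ψ (suc i)) + (∑[ i < n ] (n Cℚ suc i * ψ (suc i)) + 0ℚ * ψ (suc n)))
      ≡⟨ regroup (ψ 0) _ _ (ψ (suc n)) ⟩
    1ℚ * ψ 0 + ∑[ i < n ] (n Cℚ suc i * ψ (suc i)) + ∑[ i < suc n ] (n Cℚ i * ψ (suc i)) ∎
    where
    open ≡-Reasoning
    pascal : ∀ i → suc n Cℚ suc i * ψ (suc i) ≡ n Cℚ i * ψ (suc i) + n Cℚ suc i * ψ (suc i)
    pascal i = trans (cong (λ c → ℕ→ℚ c * ψ (suc i)) (sym (nCk+nC[k+1]≡[n+1]C[k+1] n i)))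
      (trans (cong (_* ψ (suc i)) (ℕ→ℚ-+ (n C i) (n C suc i))) (*-distribʳ-+ (ψ (suc i)) (n Cℚ i) (n Cℚ suc i)))
    regroup : ∀ a b d e → 1ℚ * a + (b + (d + 0ℚ * e)) ≡ 1ℚ * a + d + b
    regroup = solve-∀ ℚ-ring

module BooleanCube where

  open RationalArithmetic
  open import Defs
  open import Data.Bool using (true; false)
  open import Data.Fin.Subset using (Subset; _∩_; ∣_∣)
  open import Data.List using (List; []; _∷_; map; concatMap)
  open import Data.Nat as ℕ using (ℕ; zero; suc)
  open import Data.Rational hiding (∣_∣)
  open import Data.Rational.Properties
  open import Data.Vec using ([]; _∷_)
  open import Relation.Binary.PropositionalEquality
  open import Tactic.RingSolver using (solve-∀)

  module _ {X : Set} where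

    sumℚ-map-cong : ∀ (xs : List X) {f g : X → ℚ} → (∀ x → f x ≡ g x) → sumℚ (map f xs) ≡ sumℚ (map g xs)
    sumℚ-map-cong [] _ = refl
    sumℚ-map-cong (x ∷ xs) f≡g = cong₂ _+_ (f≡g x) (sumℚ-map-cong xs f≡g)

    sumℚ-map-+ : ∀ (xs : List X) (f g : X → ℚ) →
      sumℚ (map (λ x → f x + g x) xs) ≡ sumℚ (map f xs) + sumℚ (map g xs)
    sumℚ-map-+ [] _ _ = refl
    sumℚ-map-+ (x ∷ xs) f g = trans (cong (f x + g x +_) (sumℚ-map-+ xs f g)) (interchange (f x) (g x) _ _)
      where interchange : ∀ a b c d → a + b + (c + d) ≡ a + c + (b + d)
            interchange = solve-∀ ℚ-ring

    sumℚ-map-- : ∀ (xs : List X) (f g : X → ℚ) →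
      sumℚ (map (λ x → f x - g x) xs) ≡ sumℚ (map f xs) - sumℚ (map g xs)
    sumℚ-map-- [] _ _ = refl
    sumℚ-map-- (x ∷ xs) f g = trans (cong (f x - g x +_) (sumℚ-map-- xs f g)) (interchange (f x) (g x) _ _)
      where interchange : ∀ a b c d → a - b + (c - d) ≡ a + c - (b + d)
            interchange = solve-∀ ℚ-ring

    sumℚ-map-*ˡ : ∀ (xs : List X) c (f : X → ℚ) → sumℚ (map (λ x → c * f x) xs) ≡ c * sumℚ (map f xs)
    sumℚ-map-*ˡ [] c _ = sym (*-zeroʳ c)
    sumℚ-map-*ˡ (x ∷ xs) c f = trans (cong (c * f x +_) (sumℚ-map-*ˡ xs c f)) (sym (*-distribˡ-+ c (f x) _))

  cubeSum : ∀ M → (Subset M → ℚ) → ℚ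
  cubeSum M f = sumℚ (map f (allPoints M))

  cubeSum-suc : ∀ M (f : Subset (suc M) → ℚ) → cubeSum (suc M) f ≡ cubeSum M (λ v → f (true ∷ v) + f (false ∷ v))
  cubeSum-suc M f = go (allPoints M)
    where
    go : ∀ vs → sumℚ (map f (concatMap (λ v → (true ∷ v) ∷ (false ∷ v) ∷ []) vs)) ≡
                sumℚ (map (λ v → f (true ∷ v) + f (false ∷ v)) vs)
    go [] = refl
    go (v ∷ vs) = trans (cong (λ s → f (true ∷ v) + (f (false ∷ v) + s)) (go vs)) (sym (+-assoc (f (true ∷ v)) _ _))

  pow2 : ℕ → ℚ
  pow2 n = ℕ→ℚ (2 ℕ.^ n)

  pow2-suc : ∀ n → pow2 (suc n) ≡ (1ℚ + 1ℚ) * pow2 n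
  pow2-suc n = ℕ→ℚ-* 2 (2 ℕ.^ n)

  character : ∀ {M} → Subset M → Subset M → ℚ
  character T x = (- 1ℚ) ^ℚ ∣ T ∩ x ∣

  fourier : ∀ M → (Subset M → ℚ) → Subset M → ℚ
  fourier M f T = cubeSum M (λ x → f x * character T x)

  fourier-+ : ∀ M (f g : Subset M → ℚ) T → fourier M (λ x → f x + g x) T ≡ fourier M f T + fourier M g T
  fourier-+ M f g T = trans (sumℚ-map-cong (allPoints M) (λ x → *-distribʳ-+ (character T x) (f x) (g x)))
    (sumℚ-map-+ (allPoints M) (λ x → f x * character T x) (λ x → g x * character T x))

  fourier-- : ∀ M (f g : Subset M → ℚ) T → fourier M (λ x → f x - g x) T ≡ fourier M f T - fourier M g T
  fourier-- M f g T = trans (sumℚ-map-cong (allPoints M) (λ x → distrib (f x) (g x) (character T x)))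
    (sumℚ-map-- (allPoints M) (λ x → f x * character T x) (λ x → g x * character T x))
    where distrib : ∀ a b c → (a - b) * c ≡ a * c - b * c
          distrib = solve-∀ ℚ-ring

  fourier-inside : ∀ M (f : Subset (suc M) → ℚ) T →
    fourier (suc M) f (true ∷ T) ≡ fourier M (λ v → f (false ∷ v) - f (true ∷ v)) T
  fourier-inside M f T = trans (cubeSum-suc M _)
    (sumℚ-map-cong (allPoints M) (λ v → collect (f (true ∷ v)) (f (false ∷ v)) (character T v)))
    where collect : ∀ a b c → a * (- 1ℚ * c) + b * c ≡ (b - a) * c
          collect = solve-∀ ℚ-ring

  fourier-outside : ∀ M (f : Subset (suc M) → ℚ) T →
    fourier (suc M) f (false ∷ T) ≡ fourier M (λ v → f (false ∷ v) + f (true ∷ v)) T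
  fourier-outside M f T = trans (cubeSum-suc M _)
    (sumℚ-map-cong (allPoints M) (λ v → collect (f (true ∷ v)) (f (false ∷ v)) (character T v)))
    where collect : ∀ a b c → a * c + b * c ≡ (b + a) * c
          collect = solve-∀ ℚ-ring

  parseval : ∀ M (f g : Subset M → ℚ) →
    cubeSum M (λ T → fourier M f T * fourier M g T) ≡ pow2 M * cubeSum M (λ x → f x * g x)
  parseval zero f g = base (f []) (g [])
    where base : ∀ a b → (a * 1ℚ + 0ℚ) * (b * 1ℚ + 0ℚ) + 0ℚ ≡ 1ℚ * (a * b + 0ℚ)
          base = solve-∀ ℚ-ring
  parseval (suc M) f g = begin
    cubeSum (suc M) (λ T → fourier (suc M) f T * fourier (suc M) g T)
      ≡⟨ cubeSum-suc M _ ⟩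
    cubeSum M (λ T → fourier (suc M) f (true ∷ T) * fourier (suc M) g (true ∷ T)
                   + fourier (suc M) f (false ∷ T) * fourier (suc M) g (false ∷ T))
      ≡⟨ sumℚ-map-cong (allPoints M) (λ T → cong₂ _+_ (cong₂ _*_ (fourier-inside M f T) (fourier-inside M g T))
                                                     (cong₂ _*_ (fourier-outside M f T) (fourier-outside M g T))) ⟩
    cubeSum M (λ T → fourier M f₋ T * fourier M g₋ T + fourier M f₊ T * fourier M g₊ T)
      ≡⟨ sumℚ-map-+ (allPoints M) (λ T → fourier M f₋ T * fourier M g₋ T) (λ T → fourier M f₊ T * fourier M g₊ T) ⟩
    cubeSum M (λ T → fourier M f₋ T * fourier M g₋ T) + cubeSum M (λ T → fourier M f₊ T * fourier M g₊ T)
      ≡⟨ cong₂ _+_ (parseval M f₋ g₋) (parseval M f₊ g₊) ⟩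
    pow2 M * cubeSum M (λ v → f₋ v * g₋ v) + pow2 M * cubeSum M (λ v → f₊ v * g₊ v)
      ≡⟨ trans (sym (*-distribˡ-+ (pow2 M) _ _)) (cong (pow2 M *_) (sym (sumℚ-map-+ (allPoints M) _ _))) ⟩
    pow2 M * cubeSum M (λ v → f₋ v * g₋ v + f₊ v * g₊ v)
      ≡⟨ cong (pow2 M *_) (trans (sumℚ-map-cong (allPoints M) (λ v → polarise (f (false ∷ v)) (f (true ∷ v)) (g (false ∷ v)) (g (true ∷ v))))
                                 (sumℚ-map-*ˡ (allPoints M) (1ℚ + 1ℚ) _)) ⟩
    pow2 M * ((1ℚ + 1ℚ) * cubeSum M (λ v → f (true ∷ v) * g (true ∷ v) + f (false ∷ v) * g (false ∷ v)))
      ≡⟨ cong (λ s → pow2 M * ((1ℚ + 1ℚ) * s)) (sym (cubeSum-suc M (λ x → f x * g x))) ⟩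
    pow2 M * ((1ℚ + 1ℚ) * cubeSum (suc M) (λ x → f x * g x))
      ≡⟨ trans (sym (*-assoc (pow2 M) (1ℚ + 1ℚ) _))
               (cong (_* cubeSum (suc M) (λ x → f x * g x)) (trans (*-comm (pow2 M) (1ℚ + 1ℚ)) (sym (pow2-suc M)))) ⟩
    pow2 (suc M) * cubeSum (suc M) (λ x → f x * g x) ∎
    where
    open ≡-Reasoning
    f₋ f₊ g₋ g₊ : Subset M → ℚ
    f₋ v = f (false ∷ v) - f (true ∷ v)
    f₊ v = f (false ∷ v) + f (true ∷ v)
    g₋ v = g (false ∷ v) - g (true ∷ v)
    g₊ v = g (false ∷ v) + g (true ∷ v)
    polarise : ∀ a b c d → (a - b) * (c - d) + (a + b) * (c + d) ≡ (1ℚ + 1ℚ) * (b * d + a * c)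
    polarise = solve-∀ ℚ-ring

module RadialFunctions where

  open RationalArithmetic
  open FiniteSums
  open BooleanCube
  open import Defs
  open import Data.Bool using (true; false)
  open import Data.Fin.Subset using (Subset; _∩_; _─_; ∁; ⊥; ∣_∣)
  open import Data.Fin.Subset.Properties using (∩-zeroˡ; ∩-zeroʳ; ∣⊥∣≡0; p─⊥≡p)
  open import Data.Nat as ℕ using (ℕ; zero; suc)
  import Data.Nat.Properties as ℕₚ
  open import Data.Rational hiding (∣_∣)
  open import Data.Rational.Properties
  open import Data.Vec using ([]; _∷_)
  open import Relation.Binary.PropositionalEquality
  open import Tactic.RingSolver using (solve-∀)

  radial : ∀ {M} → Subset M → (ℕ → ℚ) → Subset M → ℚ
  radial S φ x = φ ∣ S ∩ x ∣

  -- The Fourier coefficient, at any set of size a, of y ↦ φ ∣ y ∣ on the cube of dimension a + b.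
  radialCoeff : ℕ → ℕ → (ℕ → ℚ) → ℚ
  radialCoeff a b φ = binomialSum a (λ i → (- 1ℚ) ^ℚ i * binomialSum b (λ l → φ (i ℕ.+ l)))

  radialCoeff-cong : ∀ a b {φ ψ : ℕ → ℚ} → (∀ j → φ j ≡ ψ j) → radialCoeff a b φ ≡ radialCoeff a b ψ
  radialCoeff-cong a b φ≡ψ =
    binomialSum-cong a (λ i → cong ((- 1ℚ) ^ℚ i *_) (binomialSum-cong b (λ l → φ≡ψ (i ℕ.+ l))))

  radialCoeff-*ˡ : ∀ a b c (φ : ℕ → ℚ) → radialCoeff a b (λ j → c * φ j) ≡ c * radialCoeff a b φ
  radialCoeff-*ˡ a b c φ = trans (binomialSum-cong a pull) (binomialSum-*ˡ a c (λ i → (- 1ℚ) ^ℚ i * binomialSum b (λ l → φ (i ℕ.+ l))))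
    where
    x*[y*z]≡y*[x*z] : ∀ x y z → x * (y * z) ≡ y * (x * z)
    x*[y*z]≡y*[x*z] = solve-∀ ℚ-ring
    pull : ∀ i → (- 1ℚ) ^ℚ i * binomialSum b (λ l → c * φ (i ℕ.+ l)) ≡ c * ((- 1ℚ) ^ℚ i * binomialSum b (λ l → φ (i ℕ.+ l)))
    pull i = trans (cong ((- 1ℚ) ^ℚ i *_) (binomialSum-*ˡ b c (λ l → φ (i ℕ.+ l))))
      (x*[y*z]≡y*[x*z] ((- 1ℚ) ^ℚ i) c (binomialSum b (λ l → φ (i ℕ.+ l))))

  radialCoeff-zeroˡ : ∀ b (φ : ℕ → ℚ) → radialCoeff 0 b φ ≡ binomialSum b φ
  radialCoeff-zeroˡ b φ = trim (binomialSum b φ)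
    where trim : ∀ x → 1ℚ * (1ℚ * x) + 0ℚ ≡ x
          trim = solve-∀ ℚ-ring

  radialCoeff-sucʳ : ∀ a b (φ : ℕ → ℚ) → radialCoeff a (suc b) φ ≡ radialCoeff a b φ + radialCoeff a b (λ j → φ (suc j))
  radialCoeff-sucʳ a b φ = trans (binomialSum-cong a split)
    (binomialSum-+ a (λ i → (- 1ℚ) ^ℚ i * binomialSum b (λ l → φ (i ℕ.+ l)))
                     (λ i → (- 1ℚ) ^ℚ i * binomialSum b (λ l → φ (suc (i ℕ.+ l)))))
    where
    split : ∀ i → (- 1ℚ) ^ℚ i * binomialSum (suc b) (λ l → φ (i ℕ.+ l)) ≡
                  (- 1ℚ) ^ℚ i * binomialSum b (λ l → φ (i ℕ.+ l)) + (- 1ℚ) ^ℚ i * binomialSum b (λ l → φ (suc (i ℕ.+ l)))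
    split i = trans (cong ((- 1ℚ) ^ℚ i *_) (trans (binomialSum-suc b (λ l → φ (i ℕ.+ l)))
                      (cong (binomialSum b (λ l → φ (i ℕ.+ l)) +_) (binomialSum-cong b (λ l → cong φ (ℕₚ.+-suc i l))))))
                    (*-distribˡ-+ ((- 1ℚ) ^ℚ i) (binomialSum b (λ l → φ (i ℕ.+ l))) (binomialSum b (λ l → φ (suc (i ℕ.+ l)))))

  radialCoeff-sucˡ : ∀ a b (φ : ℕ → ℚ) → radialCoeff (suc a) b φ ≡ radialCoeff a b φ - radialCoeff a b (λ j → φ (suc j))
  radialCoeff-sucˡ a b φ = begin
    radialCoeff (suc a) b φ
      ≡⟨ binomialSum-suc a (λ i → (- 1ℚ) ^ℚ i * binomialSum b (λ l → φ (i ℕ.+ l))) ⟩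
    radialCoeff a b φ + binomialSum a (λ i → (- 1ℚ) ^ℚ suc i * binomialSum b (λ l → φ (suc i ℕ.+ l)))
      ≡⟨ cong (radialCoeff a b φ +_) (trans (binomialSum-cong a (λ i → *-assoc (- 1ℚ) ((- 1ℚ) ^ℚ i) (binomialSum b (λ l → φ (suc (i ℕ.+ l))))))
                                          (binomialSum-*ˡ a (- 1ℚ) (λ i → (- 1ℚ) ^ℚ i * binomialSum b (λ l → φ (suc (i ℕ.+ l)))))) ⟩
    radialCoeff a b φ + - 1ℚ * radialCoeff a b (λ j → φ (suc j))
      ≡⟨ x+-1*y≡x-y (radialCoeff a b φ) (radialCoeff a b (λ j → φ (suc j))) ⟩
    radialCoeff a b φ - radialCoeff a b (λ j → φ (suc j)) ∎
    where
    open ≡-Reasoning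
    x+-1*y≡x-y : ∀ x y → x + - 1ℚ * y ≡ x - y
    x+-1*y≡x-y = solve-∀ ℚ-ring

  ⟦_⊆_⟧ : ∀ {M} → Subset M → Subset M → ℚ
  ⟦ [] ⊆ [] ⟧ = 1ℚ
  ⟦ true ∷ T ⊆ false ∷ S ⟧ = 0ℚ
  ⟦ _ ∷ T ⊆ _ ∷ S ⟧ = ⟦ T ⊆ S ⟧

  ⟦⊥⊆p⟧≡1 : ∀ {M} (S : Subset M) → ⟦ ⊥ ⊆ S ⟧ ≡ 1ℚ
  ⟦⊥⊆p⟧≡1 [] = refl
  ⟦⊥⊆p⟧≡1 (_ ∷ S) = ⟦⊥⊆p⟧≡1 S

  ⟦⊆⟧*-∩ : ∀ {M} (T S : Subset M) (F : ℕ → ℚ) → ⟦ T ⊆ S ⟧ * F ∣ S ∩ T ∣ ≡ ⟦ T ⊆ S ⟧ * F ∣ T ∣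
  ⟦⊆⟧*-∩ [] [] F = refl
  ⟦⊆⟧*-∩ (true ∷ T) (false ∷ S) F = trans (*-zeroˡ (F ∣ S ∩ T ∣)) (sym (*-zeroˡ (F (suc ∣ T ∣))))
  ⟦⊆⟧*-∩ (true ∷ T) (true ∷ S) F = ⟦⊆⟧*-∩ T S (λ j → F (suc j))
  ⟦⊆⟧*-∩ (false ∷ T) (true ∷ S) F = ⟦⊆⟧*-∩ T S F
  ⟦⊆⟧*-∩ (false ∷ T) (false ∷ S) F = ⟦⊆⟧*-∩ T S F

  ⟦⊆⟧-* : ∀ {M} (T S S′ : Subset M) → ⟦ T ⊆ S ⟧ * ⟦ T ⊆ S′ ⟧ ≡ ⟦ T ⊆ S ∩ S′ ⟧
  ⟦⊆⟧-* [] [] [] = refl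
  ⟦⊆⟧-* (true ∷ T) (true ∷ S) (true ∷ S′) = ⟦⊆⟧-* T S S′
  ⟦⊆⟧-* (true ∷ T) (true ∷ S) (false ∷ S′) = *-zeroʳ ⟦ T ⊆ S ⟧
  ⟦⊆⟧-* (true ∷ T) (false ∷ S) (s′ ∷ S′) = *-zeroˡ ⟦ true ∷ T ⊆ s′ ∷ S′ ⟧
  ⟦⊆⟧-* (false ∷ T) (true ∷ S) (true ∷ S′) = ⟦⊆⟧-* T S S′
  ⟦⊆⟧-* (false ∷ T) (true ∷ S) (false ∷ S′) = ⟦⊆⟧-* T S S′
  ⟦⊆⟧-* (false ∷ T) (false ∷ S) (true ∷ S′) = ⟦⊆⟧-* T S S′
  ⟦⊆⟧-* (false ∷ T) (false ∷ S) (false ∷ S′) = ⟦⊆⟧-* T S S′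

  ∣p∩q∣+∣p─q∣≡∣p∣ : ∀ {M} (S T : Subset M) → ∣ S ∩ T ∣ ℕ.+ ∣ S ─ T ∣ ≡ ∣ S ∣
  ∣p∩q∣+∣p─q∣≡∣p∣ [] [] = refl
  ∣p∩q∣+∣p─q∣≡∣p∣ (true ∷ S) (true ∷ T) = cong suc (∣p∩q∣+∣p─q∣≡∣p∣ S T)
  ∣p∩q∣+∣p─q∣≡∣p∣ (true ∷ S) (false ∷ T) = trans (ℕₚ.+-suc _ _) (cong suc (∣p∩q∣+∣p─q∣≡∣p∣ S T))
  ∣p∩q∣+∣p─q∣≡∣p∣ (false ∷ S) (true ∷ T) = ∣p∩q∣+∣p─q∣≡∣p∣ S T
  ∣p∩q∣+∣p─q∣≡∣p∣ (false ∷ S) (false ∷ T) = ∣p∩q∣+∣p─q∣≡∣p∣ S T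

  fourier-radial : ∀ M (S T : Subset M) (φ : ℕ → ℚ) →
    fourier M (radial S φ) T ≡ ⟦ T ⊆ S ⟧ * (pow2 ∣ ∁ S ∣ * radialCoeff ∣ S ∩ T ∣ ∣ S ─ T ∣ φ)
  fourier-radial zero [] [] φ = trans (normalise (φ 0)) (cong (λ x → 1ℚ * (1ℚ * x)) (sym (radialCoeff-zeroˡ 0 φ)))
    where normalise : ∀ a → a * 1ℚ + 0ℚ ≡ 1ℚ * (1ℚ * (1ℚ * a + 0ℚ))
          normalise = solve-∀ ℚ-ring
  fourier-radial (suc M) (false ∷ S) (false ∷ T) φ = begin
    fourier (suc M) (radial (false ∷ S) φ) (false ∷ T) ≡⟨ fourier-outside M (radial (false ∷ S) φ) T ⟩
    fourier M (λ v → radial S φ v + radial S φ v) T ≡⟨ fourier-+ M (radial S φ) (radial S φ) T ⟩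
    fourier M (radial S φ) T + fourier M (radial S φ) T ≡⟨ cong (λ x → x + x) (fourier-radial M S T φ) ⟩
    ⟦ T ⊆ S ⟧ * (pow2 ∣ ∁ S ∣ * R) + ⟦ T ⊆ S ⟧ * (pow2 ∣ ∁ S ∣ * R) ≡⟨ double ⟦ T ⊆ S ⟧ (pow2 ∣ ∁ S ∣) R ⟩
    ⟦ T ⊆ S ⟧ * ((1ℚ + 1ℚ) * pow2 ∣ ∁ S ∣ * R) ≡⟨ cong (λ p → ⟦ T ⊆ S ⟧ * (p * R)) (sym (pow2-suc ∣ ∁ S ∣)) ⟩
    ⟦ T ⊆ S ⟧ * (pow2 (suc ∣ ∁ S ∣) * R) ∎
    where
    open ≡-Reasoning
    R = radialCoeff ∣ S ∩ T ∣ ∣ S ─ T ∣ φ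
    double : ∀ i p r → i * (p * r) + i * (p * r) ≡ i * ((1ℚ + 1ℚ) * p * r)
    double = solve-∀ ℚ-ring
  fourier-radial (suc M) (false ∷ S) (true ∷ T) φ = begin
    fourier (suc M) (radial (false ∷ S) φ) (true ∷ T) ≡⟨ fourier-inside M (radial (false ∷ S) φ) T ⟩
    fourier M (λ v → radial S φ v - radial S φ v) T ≡⟨ fourier-- M (radial S φ) (radial S φ) T ⟩
    fourier M (radial S φ) T - fourier M (radial S φ) T ≡⟨ +-inverseʳ (fourier M (radial S φ) T) ⟩
    0ℚ ≡⟨ *-zeroˡ (pow2 (suc ∣ ∁ S ∣) * radialCoeff ∣ S ∩ T ∣ ∣ S ─ T ∣ φ) ⟨
    0ℚ * (pow2 (suc ∣ ∁ S ∣) * radialCoeff ∣ S ∩ T ∣ ∣ S ─ T ∣ φ) ∎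
    where open ≡-Reasoning
  fourier-radial (suc M) (true ∷ S) (false ∷ T) φ = begin
    fourier (suc M) (radial (true ∷ S) φ) (false ∷ T)
      ≡⟨ fourier-outside M (radial (true ∷ S) φ) T ⟩
    fourier M (λ v → radial S φ v + radial S (λ j → φ (suc j)) v) T
      ≡⟨ fourier-+ M (radial S φ) (radial S (λ j → φ (suc j))) T ⟩
    fourier M (radial S φ) T + fourier M (radial S (λ j → φ (suc j))) T
      ≡⟨ cong₂ _+_ (fourier-radial M S T φ) (fourier-radial M S T (λ j → φ (suc j))) ⟩
    ⟦ T ⊆ S ⟧ * (pow2 ∣ ∁ S ∣ * R φ) + ⟦ T ⊆ S ⟧ * (pow2 ∣ ∁ S ∣ * R (λ j → φ (suc j)))
      ≡⟨ factor ⟦ T ⊆ S ⟧ (pow2 ∣ ∁ S ∣) (R φ) (R (λ j → φ (suc j))) ⟩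
    ⟦ T ⊆ S ⟧ * (pow2 ∣ ∁ S ∣ * (R φ + R (λ j → φ (suc j))))
      ≡⟨ cong (λ r → ⟦ T ⊆ S ⟧ * (pow2 ∣ ∁ S ∣ * r)) (sym (radialCoeff-sucʳ ∣ S ∩ T ∣ ∣ S ─ T ∣ φ)) ⟩
    ⟦ T ⊆ S ⟧ * (pow2 ∣ ∁ S ∣ * radialCoeff ∣ S ∩ T ∣ (suc ∣ S ─ T ∣) φ) ∎
    where
    open ≡-Reasoning
    R = radialCoeff ∣ S ∩ T ∣ ∣ S ─ T ∣
    factor : ∀ i p x y → i * (p * x) + i * (p * y) ≡ i * (p * (x + y))
    factor = solve-∀ ℚ-ring
  fourier-radial (suc M) (true ∷ S) (true ∷ T) φ = begin
    fourier (suc M) (radial (true ∷ S) φ) (true ∷ T)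
      ≡⟨ fourier-inside M (radial (true ∷ S) φ) T ⟩
    fourier M (λ v → radial S φ v - radial S (λ j → φ (suc j)) v) T
      ≡⟨ fourier-- M (radial S φ) (radial S (λ j → φ (suc j))) T ⟩
    fourier M (radial S φ) T - fourier M (radial S (λ j → φ (suc j))) T
      ≡⟨ cong₂ _-_ (fourier-radial M S T φ) (fourier-radial M S T (λ j → φ (suc j))) ⟩
    ⟦ T ⊆ S ⟧ * (pow2 ∣ ∁ S ∣ * R φ) - ⟦ T ⊆ S ⟧ * (pow2 ∣ ∁ S ∣ * R (λ j → φ (suc j)))
      ≡⟨ factor ⟦ T ⊆ S ⟧ (pow2 ∣ ∁ S ∣) (R φ) (R (λ j → φ (suc j))) ⟩
    ⟦ T ⊆ S ⟧ * (pow2 ∣ ∁ S ∣ * (R φ - R (λ j → φ (suc j))))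
      ≡⟨ cong (λ r → ⟦ T ⊆ S ⟧ * (pow2 ∣ ∁ S ∣ * r)) (sym (radialCoeff-sucˡ ∣ S ∩ T ∣ ∣ S ─ T ∣ φ)) ⟩
    ⟦ T ⊆ S ⟧ * (pow2 ∣ ∁ S ∣ * radialCoeff (suc ∣ S ∩ T ∣) ∣ S ─ T ∣ φ) ∎
    where
    open ≡-Reasoning
    R = radialCoeff ∣ S ∩ T ∣ ∣ S ─ T ∣
    factor : ∀ i p x y → i * (p * x) - i * (p * y) ≡ i * (p * (x - y))
    factor = solve-∀ ℚ-ring

  cubeSum-radial : ∀ M (S : Subset M) (φ : ℕ → ℚ) → cubeSum M (radial S φ) ≡ pow2 ∣ ∁ S ∣ * binomialSum ∣ S ∣ φ
  cubeSum-radial M S φ = begin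
    cubeSum M (radial S φ)
      ≡⟨ sumℚ-map-cong (allPoints M) (λ x → sym (trivial-character x)) ⟩
    fourier M (radial S φ) ⊥
      ≡⟨ fourier-radial M S ⊥ φ ⟩
    ⟦ ⊥ ⊆ S ⟧ * (pow2 ∣ ∁ S ∣ * radialCoeff ∣ S ∩ ⊥ ∣ ∣ S ─ ⊥ ∣ φ)
      ≡⟨ cong₂ (λ i r → i * (pow2 ∣ ∁ S ∣ * r)) (⟦⊥⊆p⟧≡1 S)
               (cong₂ (λ a b → radialCoeff a b φ) (trans (cong ∣_∣ (∩-zeroʳ S)) (∣⊥∣≡0 M)) (cong ∣_∣ (p─⊥≡p S))) ⟩
    1ℚ * (pow2 ∣ ∁ S ∣ * radialCoeff 0 ∣ S ∣ φ)
      ≡⟨ trans (*-identityˡ (pow2 ∣ ∁ S ∣ * radialCoeff 0 ∣ S ∣ φ)) (cong (pow2 ∣ ∁ S ∣ *_) (radialCoeff-zeroˡ ∣ S ∣ φ)) ⟩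
    pow2 ∣ ∁ S ∣ * binomialSum ∣ S ∣ φ ∎
    where
    open ≡-Reasoning
    trivial-character : ∀ x → radial S φ x * character ⊥ x ≡ radial S φ x
    trivial-character x = trans (cong (λ n → radial S φ x * (- 1ℚ) ^ℚ n) (trans (cong ∣_∣ (∩-zeroˡ x)) (∣⊥∣≡0 M)))
                                (*-identityʳ (radial S φ x))

  cubeSum-⊆ : ∀ M (L : Subset M) (ψ : ℕ → ℚ) → cubeSum M (λ T → ⟦ T ⊆ L ⟧ * ψ ∣ T ∣) ≡ binomialSum ∣ L ∣ ψ
  cubeSum-⊆ zero [] ψ = refl
  cubeSum-⊆ (suc M) (false ∷ L) ψ = trans (cubeSum-suc M (λ T → ⟦ T ⊆ false ∷ L ⟧ * ψ ∣ T ∣))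
    (trans (sumℚ-map-cong (allPoints M) (λ T → 0*a+b≡b (ψ (suc ∣ T ∣)) (⟦ T ⊆ L ⟧ * ψ ∣ T ∣))) (cubeSum-⊆ M L ψ))
    where 0*a+b≡b : ∀ a b → 0ℚ * a + b ≡ b
          0*a+b≡b = solve-∀ ℚ-ring
  cubeSum-⊆ (suc M) (true ∷ L) ψ = begin
    cubeSum (suc M) (λ T → ⟦ T ⊆ true ∷ L ⟧ * ψ ∣ T ∣)
      ≡⟨ cubeSum-suc M (λ T → ⟦ T ⊆ true ∷ L ⟧ * ψ ∣ T ∣) ⟩
    cubeSum M (λ T → ⟦ T ⊆ L ⟧ * ψ (suc ∣ T ∣) + ⟦ T ⊆ L ⟧ * ψ ∣ T ∣)
      ≡⟨ sumℚ-map-+ (allPoints M) (λ T → ⟦ T ⊆ L ⟧ * ψ (suc ∣ T ∣)) (λ T → ⟦ T ⊆ L ⟧ * ψ ∣ T ∣) ⟩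
    cubeSum M (λ T → ⟦ T ⊆ L ⟧ * ψ (suc ∣ T ∣)) + cubeSum M (λ T → ⟦ T ⊆ L ⟧ * ψ ∣ T ∣)
      ≡⟨ cong₂ _+_ (cubeSum-⊆ M L (λ j → ψ (suc j))) (cubeSum-⊆ M L ψ) ⟩
    binomialSum l (λ j → ψ (suc j)) + binomialSum l ψ
      ≡⟨ +-comm (binomialSum l (λ j → ψ (suc j))) (binomialSum l ψ) ⟩
    binomialSum l ψ + binomialSum l (λ j → ψ (suc j))
      ≡⟨ binomialSum-suc l ψ ⟨
    binomialSum (suc l) ψ ∎
    where
    open ≡-Reasoning
    l = ∣ L ∣

module KravchukSums where

  open RationalArithmetic
  open FiniteSums
  open Binomial using (C-pos; C-choose-twice)
  open import Defs
  open import Data.Integer as ℤ using (ℤ; +_)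
  open import Data.List using (map; applyUpTo)
  open import Data.Nat as ℕ using (ℕ; zero; suc; z≤n; s≤s; _∸_)
  import Data.Nat.Properties as ℕₚ
  open import Data.Nat.Combinatorics using (_C_; k>n⇒nCk≡0)
  import Data.Nat.Tactic.RingSolver as ℕ-Solver
  open import Data.Rational
  open import Data.Rational.Properties
  open import Relation.Binary.PropositionalEquality
  open import Tactic.RingSolver using (solve-∀)

  ℤ→ℚ-sign : ∀ i → ℤ→ℚ (sign i) ≡ (- 1ℚ) ^ℚ i
  ℤ→ℚ-sign zero = refl
  ℤ→ℚ-sign (suc zero) = refl
  ℤ→ℚ-sign (suc (suc i)) = trans (ℤ→ℚ-sign i) (-1*[-1*x]≡x ((- 1ℚ) ^ℚ i))
    where -1*[-1*x]≡x : ∀ x → x ≡ - 1ℚ * (- 1ℚ * x)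
          -1*[-1*x]≡x = solve-∀ ℚ-ring

  kravchuk-as-∑ : ∀ t x m → ℤ→ℚ (Kravchuk t x m) ≡ ∑[ i < suc t ] ((- 1ℚ) ^ℚ i * (x Cℚ i * (m ∸ x) Cℚ (t ∸ i)))
  kravchuk-as-∑ t x m = trans (go (suc t) (λ i → i)) (∑-cong (suc t) term)
    where
    g : ℕ → ℤ
    g j = sign j ℤ.* + ((x C j) ℕ.* ((m ∸ x) C (t ∸ j)))
    go : ∀ n (f : ℕ → ℕ) → ℤ→ℚ (sumℤ (map g (applyUpTo f n))) ≡ ∑[ i < n ] ℤ→ℚ (g (f i))
    go zero f = refl
    go (suc n) f = trans (ℤ→ℚ-+ (g (f 0)) _) (cong (λ s → ℤ→ℚ (g (f 0)) + s) (go n (λ i → f (suc i))))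
    term : ∀ i → ℤ→ℚ (g i) ≡ (- 1ℚ) ^ℚ i * (x Cℚ i * (m ∸ x) Cℚ (t ∸ i))
    term i = trans (ℤ→ℚ-* (sign i) _) (cong₂ _*_ (ℤ→ℚ-sign i) (ℕ→ℚ-* (x C i) ((m ∸ x) C (t ∸ i))))

  choose-twice-÷ : ∀ (B : ℕ → ℚ) i p r {l} → l ℕ.≤ r →
    (i ℕ.+ p ℕ.+ r) Cℚ (i ℕ.+ p) * ((i ℕ.+ p) Cℚ i * (r Cℚ l * (B (i ℕ.+ l) ÷ℕ ((i ℕ.+ p ℕ.+ r) C (i ℕ.+ l))))) ≡
    B (i ℕ.+ l) * ((i ℕ.+ l) Cℚ i * (i ℕ.+ p ℕ.+ r ∸ (i ℕ.+ l)) Cℚ p)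
  choose-twice-÷ B i p r {l} l≤r = begin
    n Cℚ t * (t Cℚ i * (r Cℚ l * h))
      ≡⟨ reassoc (n Cℚ t) (t Cℚ i) (r Cℚ l) h ⟩
    n Cℚ t * (t Cℚ i * r Cℚ l) * h
      ≡⟨ cong (_* h) (ℕ→ℚ-*³ (n C t) (t C i) (r C l)) ⟨
    ℕ→ℚ ((n C t) ℕ.* ((t C i) ℕ.* (r C l))) * h
      ≡⟨ cong (λ c → ℕ→ℚ c * h) choose-twice ⟩
    ℕ→ℚ ((n C x) ℕ.* ((x C i) ℕ.* ((n ∸ x) C p))) * h
      ≡⟨ cong (_* h) (ℕ→ℚ-*³ (n C x) (x C i) ((n ∸ x) C p)) ⟩
    n Cℚ x * (x Cℚ i * (n ∸ x) Cℚ p) * h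
      ≡⟨ swap (n Cℚ x) (x Cℚ i * (n ∸ x) Cℚ p) h ⟩
    n Cℚ x * h * (x Cℚ i * (n ∸ x) Cℚ p)
      ≡⟨ cong (_* (x Cℚ i * (n ∸ x) Cℚ p)) (*-÷ℕ-cancel (B x) (C-pos x≤n)) ⟩
    B x * (x Cℚ i * (n ∸ x) Cℚ p) ∎
    where
    open ≡-Reasoning
    t = i ℕ.+ p
    n = t ℕ.+ r
    x = i ℕ.+ l
    h = B x ÷ℕ (n C x)
    n∸t≡r : n ∸ t ≡ r
    n∸t≡r = ℕₚ.m+n∸m≡n t r
    x≤n : x ℕ.≤ n
    x≤n = ℕₚ.≤-trans (ℕₚ.+-monoʳ-≤ i (ℕₚ.≤-trans l≤r (ℕₚ.m≤n+m r p))) (ℕₚ.≤-reflexive (sym (ℕₚ.+-assoc i p r)))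
    choose-twice : (n C t) ℕ.* ((t C i) ℕ.* (r C l)) ≡ (n C x) ℕ.* ((x C i) ℕ.* ((n ∸ x) C p))
    choose-twice =
      trans (cong (λ s → (n C t) ℕ.* ((t C i) ℕ.* (s C l))) (sym n∸t≡r))
        (trans (C-choose-twice (ℕₚ.m≤m+n i p) (ℕₚ.m≤m+n t r) (subst (l ℕ.≤_) (sym n∸t≡r) l≤r))
          (cong (λ q → (n C x) ℕ.* ((x C i) ℕ.* ((n ∸ x) C q))) (ℕₚ.m+n∸m≡n i p)))
    ℕ→ℚ-*³ : ∀ a b c → ℕ→ℚ (a ℕ.* (b ℕ.* c)) ≡ ℕ→ℚ a * (ℕ→ℚ b * ℕ→ℚ c)
    ℕ→ℚ-*³ a b c = trans (ℕ→ℚ-* a (b ℕ.* c)) (cong (ℕ→ℚ a *_) (ℕ→ℚ-* b c))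
    reassoc : ∀ a b c d → a * (b * (c * d)) ≡ a * (b * c) * d
    reassoc = solve-∀ ℚ-ring
    swap : ∀ a b c → a * b * c ≡ a * c * b
    swap = solve-∀ ℚ-ring

  -- Only x = i + l with l ≤ n − t contribute; for those, choose-twice-÷ applies.
  kravchuk-column : ∀ (B : ℕ → ℚ) {n t i} → i ℕ.≤ t → t ℕ.≤ n →
    ∑[ x < suc n ] (B x * (x Cℚ i * (n ∸ x) Cℚ (t ∸ i))) ≡
    n Cℚ t * (t Cℚ i * binomialSum (n ∸ t) (λ l → B (i ℕ.+ l) ÷ℕ (n C (i ℕ.+ l))))
  kravchuk-column B {n} {t} {i} i≤t t≤n = go (ℕₚ.m+[n∸m]≡n i≤t) (ℕₚ.m+[n∸m]≡n t≤n)
    where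
    go : ∀ {n t p r} → i ℕ.+ p ≡ t → t ℕ.+ r ≡ n →
      ∑[ x < suc n ] (B x * (x Cℚ i * (n ∸ x) Cℚ p)) ≡
      n Cℚ t * (t Cℚ i * binomialSum r (λ l → B (i ℕ.+ l) ÷ℕ (n C (i ℕ.+ l))))
    go {p = p} {r} refl refl = begin
      ∑ (suc n′) G                           ≡⟨ cong (λ k → ∑ k G) (size i p r) ⟩
      ∑ (i ℕ.+ (suc r ℕ.+ p)) G              ≡⟨ ∑-drop i (suc r ℕ.+ p) G below ⟩
      ∑[ l < suc r ℕ.+ p ] G (i ℕ.+ l)        ≡⟨ ∑-extend (suc r) p (λ l → G (i ℕ.+ l)) above ⟩
      ∑[ l < suc r ] G (i ℕ.+ l)              ≡⟨ ∑-cong< (suc r) (λ l l<1+r → choose-twice-÷ B i p r (ℕₚ.≤-pred l<1+r)) ⟨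
      ∑[ l < suc r ] (n′ Cℚ t′ * (t′ Cℚ i * (r Cℚ l * h (i ℕ.+ l))))
        ≡⟨ trans (∑-*ˡ (suc r) (n′ Cℚ t′) (λ l → t′ Cℚ i * (r Cℚ l * h (i ℕ.+ l))))
                 (cong (n′ Cℚ t′ *_) (∑-*ˡ (suc r) (t′ Cℚ i) (λ l → r Cℚ l * h (i ℕ.+ l)))) ⟩
      n′ Cℚ t′ * (t′ Cℚ i * binomialSum r (λ l → h (i ℕ.+ l))) ∎
      where
      open ≡-Reasoning
      t′ = i ℕ.+ p
      n′ = t′ ℕ.+ r
      h : ℕ → ℚ
      h j = B j ÷ℕ (n′ C j)
      G : ℕ → ℚ
      G x = B x * (x Cℚ i * (n′ ∸ x) Cℚ p)
      size : ∀ i p r → suc ((i ℕ.+ p) ℕ.+ r) ≡ i ℕ.+ (suc r ℕ.+ p)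
      size = ℕ-Solver.solve-∀
      below : ∀ x → x ℕ.< i → G x ≡ 0ℚ
      below x x<i = trans (cong (λ c → B x * (ℕ→ℚ c * (n′ ∸ x) Cℚ p)) (k>n⇒nCk≡0 x<i))
                          (trans (cong (B x *_) (*-zeroˡ ((n′ ∸ x) Cℚ p))) (*-zeroʳ (B x)))
      above : ∀ e → e ℕ.< p → G (i ℕ.+ (suc r ℕ.+ e)) ≡ 0ℚ
      above e e<p = trans (cong (λ c → B x * (x Cℚ i * ℕ→ℚ c)) (k>n⇒nCk≡0 n′∸x<p))
                          (trans (cong (B x *_) (*-zeroʳ (x Cℚ i))) (*-zeroʳ (B x)))
        where
        x = i ℕ.+ (suc r ℕ.+ e)
        n′∸x≡p∸1+e : n′ ∸ x ≡ p ∸ suc e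
        n′∸x≡p∸1+e = begin
          n′ ∸ x ≡⟨ cong (_∸ x) (ℕₚ.+-assoc i p r) ⟩
          i ℕ.+ (p ℕ.+ r) ∸ x ≡⟨ ℕₚ.[m+n]∸[m+o]≡n∸o i (p ℕ.+ r) (suc r ℕ.+ e) ⟩
          p ℕ.+ r ∸ (suc r ℕ.+ e) ≡⟨ cong₂ _∸_ (ℕₚ.+-comm p r) (sym (ℕₚ.+-suc r e)) ⟩
          r ℕ.+ p ∸ (r ℕ.+ suc e) ≡⟨ ℕₚ.[m+n]∸[m+o]≡n∸o r p (suc e) ⟩
          p ∸ suc e ∎
        n′∸x<p : n′ ∸ x ℕ.< p
        n′∸x<p = subst (ℕ._< p) (sym n′∸x≡p∸1+e) (ℕₚ.∸-monoʳ-< {p} {suc e} {0} (s≤s z≤n) e<p)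

module PlantedDistribution (m : ℕ) (A : ℕ → ℚ) where

  open RationalArithmetic
  open FiniteSums
  open BooleanCube
  open RadialFunctions
  open KravchukSums
  open Binomial using (C-pos; C-monoˡ-≤)
  open import Defs
  open import Data.Fin.Subset using (Subset; _∩_; _─_; ∁; ⊤; ∣_∣)
  open import Data.Fin.Subset.Properties using (∣∁p∣≡n∸∣p∣; ∣⊤∣≡n; ∩-idem; ∣p∩q∣≤∣p∣)
  open import Data.Nat as ℕ using (ℕ; suc; s≤s; _∸_)
  import Data.Nat.Properties as ℕₚ
  open import Data.Nat.Combinatorics using (_C_; k>n⇒nCk≡0)
  open import Data.Rational hiding (∣_∣)
  import Data.Rational as ℚ
  open import Data.Rational.Properties
  open import Relation.Binary.PropositionalEquality
  open import Tactic.RingSolver using (solve-∀)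

  pointMass : ℕ → ℚ
  pointMass j = A j ÷ℕ (m C j)

  coeff : ℕ → ℚ
  coeff t = radialCoeff t (m ∸ t) pointMass

  levelWeight : ℕ → ℕ → ℚ
  levelWeight n t = n Cℚ t * (coeff t * coeff t)

  fourier-P : ∀ {M} (S : Subset M) → ∣ S ∣ ≡ m → ∀ T → fourier M (P M m A S) T ≡ ⟦ T ⊆ S ⟧ * coeff ∣ S ∩ T ∣
  fourier-P {M} S ∣S∣≡m T = trans (fourier-radial M S T φ) (cong (⟦ T ⊆ S ⟧ *_) (begin
    pow2 ∣ ∁ S ∣ * radialCoeff a ∣ S ─ T ∣ φ
      ≡⟨ cong₂ (λ c b → pow2 c * radialCoeff a b φ) ∣∁S∣≡M∸m ∣S─T∣≡m∸a ⟩
    pow2 (M ∸ m) * radialCoeff a (m ∸ a) φ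
      ≡⟨ radialCoeff-*ˡ a (m ∸ a) (pow2 (M ∸ m)) φ ⟨
    radialCoeff a (m ∸ a) (λ j → pow2 (M ∸ m) * φ j)
      ≡⟨ radialCoeff-cong a (m ∸ a) (λ j → ÷ℕ-*-cancelˡ (A j) (m C j) (ℕₚ.m^n>0 2 (M ∸ m))) ⟩
    coeff a ∎))
    where
    open ≡-Reasoning
    a = ∣ S ∩ T ∣
    φ : ℕ → ℚ
    φ j = A j ÷ℕ (2 ℕ.^ (M ∸ m) ℕ.* (m C j))
    ∣∁S∣≡M∸m : ∣ ∁ S ∣ ≡ M ∸ m
    ∣∁S∣≡M∸m = trans (∣∁p∣≡n∸∣p∣ S) (cong (M ∸_) ∣S∣≡m)
    ∣S─T∣≡m∸a : ∣ S ─ T ∣ ≡ m ∸ a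
    ∣S─T∣≡m∸a = trans (sym (ℕₚ.m+n∸m≡n a ∣ S ─ T ∣)) (cong (_∸ a) (trans (∣p∩q∣+∣p─q∣≡∣p∣ S T) ∣S∣≡m))

  correlation-P : ∀ {M} (S S′ : Subset M) → ∣ S ∣ ≡ m → ∣ S′ ∣ ≡ m →
    cubeSum M (λ x → P M m A S x * P M m A S′ x * pow2 M) ≡ binomialSum ∣ S ∩ S′ ∣ (λ t → coeff t * coeff t)
  correlation-P {M} S S′ ∣S∣≡m ∣S′∣≡m = begin
    cubeSum M (λ x → PS x * PS′ x * pow2 M)
      ≡⟨ sumℚ-map-cong (allPoints M) (λ x → *-comm (PS x * PS′ x) (pow2 M)) ⟩
    cubeSum M (λ x → pow2 M * (PS x * PS′ x))
      ≡⟨ sumℚ-map-*ˡ (allPoints M) (pow2 M) (λ x → PS x * PS′ x) ⟩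
    pow2 M * cubeSum M (λ x → PS x * PS′ x)
      ≡⟨ parseval M PS PS′ ⟨
    cubeSum M (λ T → fourier M PS T * fourier M PS′ T)
      ≡⟨ sumℚ-map-cong (allPoints M) (λ T → cong₂ _*_ (fourier-P S ∣S∣≡m T) (fourier-P S′ ∣S′∣≡m T)) ⟩
    cubeSum M (λ T → (⟦ T ⊆ S ⟧ * coeff ∣ S ∩ T ∣) * (⟦ T ⊆ S′ ⟧ * coeff ∣ S′ ∩ T ∣))
      ≡⟨ sumℚ-map-cong (allPoints M) restrict ⟩
    cubeSum M (λ T → ⟦ T ⊆ S ∩ S′ ⟧ * (coeff ∣ T ∣ * coeff ∣ T ∣))
      ≡⟨ cubeSum-⊆ M (S ∩ S′) (λ t → coeff t * coeff t) ⟩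
    binomialSum ∣ S ∩ S′ ∣ (λ t → coeff t * coeff t) ∎
    where
    open ≡-Reasoning
    PS PS′ : Subset M → ℚ
    PS = P M m A S
    PS′ = P M m A S′
    interchange : ∀ a b c → (a * c) * (b * c) ≡ (a * b) * (c * c)
    interchange = solve-∀ ℚ-ring
    restrict : ∀ T → (⟦ T ⊆ S ⟧ * coeff ∣ S ∩ T ∣) * (⟦ T ⊆ S′ ⟧ * coeff ∣ S′ ∩ T ∣) ≡
                     ⟦ T ⊆ S ∩ S′ ⟧ * (coeff ∣ T ∣ * coeff ∣ T ∣)
    restrict T = trans (cong₂ _*_ (⟦⊆⟧*-∩ T S coeff) (⟦⊆⟧*-∩ T S′ coeff))
      (trans (interchange ⟦ T ⊆ S ⟧ ⟦ T ⊆ S′ ⟧ (coeff ∣ T ∣)) (cong (_* (coeff ∣ T ∣ * coeff ∣ T ∣)) (⟦⊆⟧-* T S S′)))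

  coeff-zero : Σ[0… m ] A ≡ 1ℚ → coeff 0 ≡ 1ℚ
  coeff-zero ΣA≡1 = begin
    coeff 0 ≡⟨ radialCoeff-zeroˡ m pointMass ⟩
    binomialSum m pointMass ≡⟨ ∑-cong< (suc m) (λ j j<1+m → *-÷ℕ-cancel (A j) (C-pos (ℕₚ.≤-pred j<1+m))) ⟩
    ∑ (suc m) A ≡⟨ Σ[0…]≡∑ m A ⟨
    Σ[0… m ] A ≡⟨ ΣA≡1 ⟩
    1ℚ ∎
    where open ≡-Reasoning

  binomialSum-coeff²-1 : Σ[0… m ] A ≡ 1ℚ → ∀ n →
    binomialSum n (λ t → coeff t * coeff t) - 1ℚ ≡ ∑[ t < n ] levelWeight n (suc t)
  binomialSum-coeff²-1 ΣA≡1 n = begin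
    1ℚ * (coeff 0 * coeff 0) + ∑[ t < n ] levelWeight n (suc t) - 1ℚ
      ≡⟨ cong (λ c → 1ℚ * (c * c) + ∑[ t < n ] levelWeight n (suc t) - 1ℚ) (coeff-zero ΣA≡1) ⟩
    1ℚ * (1ℚ * 1ℚ) + ∑[ t < n ] levelWeight n (suc t) - 1ℚ
      ≡⟨ cancel (∑[ t < n ] levelWeight n (suc t)) ⟩
    ∑[ t < n ] levelWeight n (suc t) ∎
    where
    open ≡-Reasoning
    cancel : ∀ x → 1ℚ * (1ℚ * 1ℚ) + x - 1ℚ ≡ x
    cancel = solve-∀ ℚ-ring

  chiU-as-∑ : ∀ {M} (S S′ : Subset M) → ∣ S ∣ ≡ m → ∣ S′ ∣ ≡ m → Σ[0… m ] A ≡ 1ℚ →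
    chiU M (P M m A S) (P M m A S′) ≡ ∑[ t < m ] levelWeight ∣ S ∩ S′ ∣ (suc t)
  chiU-as-∑ {M} S S′ ∣S∣≡m ∣S′∣≡m ΣA≡1 = begin
    chiU M (P M m A S) (P M m A S′)
      ≡⟨ cong (_- 1ℚ) (correlation-P S S′ ∣S∣≡m ∣S′∣≡m) ⟩
    binomialSum ℓ (λ t → coeff t * coeff t) - 1ℚ
      ≡⟨ binomialSum-coeff²-1 ΣA≡1 ℓ ⟩
    ∑[ t < ℓ ] levelWeight ℓ (suc t)
      ≡⟨ ∑-extend ℓ (m ∸ ℓ) (λ t → levelWeight ℓ (suc t)) (λ e _ → beyond e) ⟨
    ∑[ t < ℓ ℕ.+ (m ∸ ℓ) ] levelWeight ℓ (suc t)
      ≡⟨ cong (λ n → ∑[ t < n ] levelWeight ℓ (suc t)) (ℕₚ.m+[n∸m]≡n ℓ≤m) ⟩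
    ∑[ t < m ] levelWeight ℓ (suc t) ∎
    where
    open ≡-Reasoning
    ℓ = ∣ S ∩ S′ ∣
    ℓ≤m : ℓ ℕ.≤ m
    ℓ≤m = subst (ℓ ℕ.≤_) ∣S∣≡m (∣p∩q∣≤∣p∣ S S′)
    beyond : ∀ e → levelWeight ℓ (suc (ℓ ℕ.+ e)) ≡ 0ℚ
    beyond e = trans (cong (λ c → ℕ→ℚ c * (coeff (suc (ℓ ℕ.+ e)) * coeff (suc (ℓ ℕ.+ e))))
                           (k>n⇒nCk≡0 (s≤s (ℕₚ.m≤m+n ℓ e))))
                     (*-zeroˡ (coeff (suc (ℓ ℕ.+ e)) * coeff (suc (ℓ ℕ.+ e))))

  binomial*pointMass² : ∀ {j} → j ℕ.≤ m → m Cℚ j * (pointMass j * pointMass j * pow2 m) ≡ (A j * A j * pow2 m) ÷ℕ (m C j)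
  binomial*pointMass² {j} j≤m = begin
    m Cℚ j * (pointMass j * pointMass j * pow2 m)
      ≡⟨ cong (λ h → m Cℚ j * (h * h * pow2 m)) (÷ℕ-as-* (A j) (m C j)) ⟩
    m Cℚ j * (A j * 1÷C * (A j * 1÷C) * pow2 m)
      ≡⟨ regroup (m Cℚ j) (A j) (pow2 m) 1÷C ⟩
    A j * A j * pow2 m * 1÷C * (m Cℚ j * 1÷C)
      ≡⟨ cong (A j * A j * pow2 m * 1÷C *_) (ℕ→ℚ*1÷ℕ≡1 (C-pos j≤m)) ⟩
    A j * A j * pow2 m * 1÷C * 1ℚ
      ≡⟨ trans (*-identityʳ _) (sym (÷ℕ-as-* (A j * A j * pow2 m) (m C j))) ⟩
    (A j * A j * pow2 m) ÷ℕ (m C j) ∎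
    where
    open ≡-Reasoning
    1÷C = 1ℚ ÷ℕ (m C j)
    regroup : ∀ c a p i → c * (a * i * (a * i) * p) ≡ a * a * p * i * (c * i)
    regroup = solve-∀ ℚ-ring

  -- Parseval on {0,1}^m for x ↦ pointMass ∣ x ∣, which is the planted distribution with M = m and S = ⊤.
  chiSqBin-as-∑ : Σ[0… m ] A ≡ 1ℚ → chiSqBin m A ≡ ∑[ t < m ] levelWeight m (suc t)
  chiSqBin-as-∑ ΣA≡1 = begin
    chiSqBin m A
      ≡⟨ cong (_- 1ℚ) (Σ[0…]≡∑ m (λ j → (A j * A j * pow2 m) ÷ℕ (m C j))) ⟩
    ∑[ j < suc m ] ((A j * A j * pow2 m) ÷ℕ (m C j)) - 1ℚ
      ≡⟨ cong (_- 1ℚ) (∑-cong< (suc m) (λ j j<1+m → binomial*pointMass² (ℕₚ.≤-pred j<1+m))) ⟨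
    binomialSum m (λ j → pointMass j * pointMass j * pow2 m) - 1ℚ
      ≡⟨ cong (_- 1ℚ) (binomialSum-cong m (λ j → cong (λ h → h * h * pow2 m) (φ≡pointMass j))) ⟨
    binomialSum m ψ - 1ℚ
      ≡⟨ cong (_- 1ℚ) (trans (cong₂ (λ c n → pow2 c * binomialSum n ψ) ∣∁⊤∣≡0 (∣⊤∣≡n m)) (*-identityˡ (binomialSum m ψ))) ⟨
    pow2 ∣∁⊤∣ * binomialSum ∣⊤∣ ψ - 1ℚ
      ≡⟨ cong (_- 1ℚ) (cubeSum-radial m ⊤ₘ ψ) ⟨
    cubeSum m (λ x → P m m A ⊤ₘ x * P m m A ⊤ₘ x * pow2 m) - 1ℚ
      ≡⟨ cong (_- 1ℚ) (correlation-P ⊤ₘ ⊤ₘ (∣⊤∣≡n m) (∣⊤∣≡n m)) ⟩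
    binomialSum ∣ ⊤ₘ ∩ ⊤ₘ ∣ (λ t → coeff t * coeff t) - 1ℚ
      ≡⟨ cong (λ n → binomialSum n (λ t → coeff t * coeff t) - 1ℚ) (trans (cong ∣_∣ (∩-idem ⊤ₘ)) (∣⊤∣≡n m)) ⟩
    binomialSum m (λ t → coeff t * coeff t) - 1ℚ
      ≡⟨ binomialSum-coeff²-1 ΣA≡1 m ⟩
    ∑[ t < m ] levelWeight m (suc t) ∎
    where
    open ≡-Reasoning
    ⊤ₘ : Subset m
    ⊤ₘ = ⊤
    ∣∁⊤∣ ∣⊤∣ : ℕ
    ∣∁⊤∣ = ∣ ∁ ⊤ₘ ∣
    ∣⊤∣ = ∣ ⊤ₘ ∣
    ∣∁⊤∣≡0 : ∣∁⊤∣ ≡ 0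
    ∣∁⊤∣≡0 = trans (∣∁p∣≡n∸∣p∣ ⊤ₘ) (trans (cong (m ∸_) (∣⊤∣≡n m)) (ℕₚ.n∸n≡0 m))
    φ : ℕ → ℚ
    φ j = A j ÷ℕ (2 ℕ.^ (m ∸ m) ℕ.* (m C j))
    φ≡pointMass : ∀ j → φ j ≡ pointMass j
    φ≡pointMass j = cong (A j ÷ℕ_) (trans (cong (λ e → 2 ℕ.^ e ℕ.* (m C j)) (ℕₚ.n∸n≡0 m)) (ℕₚ.*-identityˡ (m C j)))
    ψ : ℕ → ℚ
    ψ j = φ j * φ j * pow2 m

  EKravchuk-as-coeff : ∀ {t} → t ℕ.≤ m → EKravchuk m A t ≡ m Cℚ t * coeff t
  EKravchuk-as-coeff {t} t≤m = begin
    EKravchuk m A t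
      ≡⟨ Σ[0…]≡∑ m (λ x → A x * ℤ→ℚ (Kravchuk t x m)) ⟩
    ∑[ x < suc m ] (A x * ℤ→ℚ (Kravchuk t x m))
      ≡⟨ ∑-cong (suc m) (λ x → trans (cong (A x *_) (kravchuk-as-∑ t x m)) (sym (∑-*ˡ (suc t) (A x) (K x)))) ⟩
    ∑[ x < suc m ] ∑[ i < suc t ] (A x * K x i)
      ≡⟨ ∑-swap (suc m) (suc t) (λ x i → A x * K x i) ⟩
    ∑[ i < suc t ] ∑[ x < suc m ] (A x * K x i)
      ≡⟨ ∑-cong< (suc t) column ⟩
    ∑[ i < suc t ] (m Cℚ t * (t Cℚ i * ((- 1ℚ) ^ℚ i * X i)))
      ≡⟨ ∑-*ˡ (suc t) (m Cℚ t) (λ i → t Cℚ i * ((- 1ℚ) ^ℚ i * X i)) ⟩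
    m Cℚ t * coeff t ∎
    where
    open ≡-Reasoning
    K : ℕ → ℕ → ℚ
    K x i = (- 1ℚ) ^ℚ i * (x Cℚ i * (m ∸ x) Cℚ (t ∸ i))
    X : ℕ → ℚ
    X i = binomialSum (m ∸ t) (λ l → pointMass (i ℕ.+ l))
    x*[s*y]≡s*[x*y] : ∀ x s y → x * (s * y) ≡ s * (x * y)
    x*[s*y]≡s*[x*y] = solve-∀ ℚ-ring
    s*[a*[b*x]]≡a*[b*[s*x]] : ∀ s a b x → s * (a * (b * x)) ≡ a * (b * (s * x))
    s*[a*[b*x]]≡a*[b*[s*x]] = solve-∀ ℚ-ring
    column : ∀ i → i ℕ.< suc t → ∑[ x < suc m ] (A x * K x i) ≡ m Cℚ t * (t Cℚ i * ((- 1ℚ) ^ℚ i * X i))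
    column i (s≤s i≤t) = begin
      ∑[ x < suc m ] (A x * K x i)
        ≡⟨ ∑-cong (suc m) (λ x → x*[s*y]≡s*[x*y] (A x) ((- 1ℚ) ^ℚ i) (x Cℚ i * (m ∸ x) Cℚ (t ∸ i))) ⟩
      ∑[ x < suc m ] ((- 1ℚ) ^ℚ i * (A x * (x Cℚ i * (m ∸ x) Cℚ (t ∸ i))))
        ≡⟨ ∑-*ˡ (suc m) ((- 1ℚ) ^ℚ i) (λ x → A x * (x Cℚ i * (m ∸ x) Cℚ (t ∸ i))) ⟩
      (- 1ℚ) ^ℚ i * ∑[ x < suc m ] (A x * (x Cℚ i * (m ∸ x) Cℚ (t ∸ i)))
        ≡⟨ cong ((- 1ℚ) ^ℚ i *_) (kravchuk-column A i≤t t≤m) ⟩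
      (- 1ℚ) ^ℚ i * (m Cℚ t * (t Cℚ i * X i))
        ≡⟨ s*[a*[b*x]]≡a*[b*[s*x]] ((- 1ℚ) ^ℚ i) (m Cℚ t) (t Cℚ i) (X i) ⟩
      m Cℚ t * (t Cℚ i * ((- 1ℚ) ^ℚ i * X i)) ∎

  levelWeight-nonNeg : ∀ n t → 0ℚ ≤ levelWeight n t
  levelWeight-nonNeg n t = *-nonNeg (ℕ→ℚ-nonNeg (n C t)) (square-nonNeg (coeff t))

  levelWeight-low : ∀ {ℓ t ν} → ℓ ℕ.≤ m → t ℕ.≤ m → ℚ.∣ EKravchuk m A t ∣ ≤ ν → levelWeight ℓ t ≤ ν * ν
  levelWeight-low {ℓ} {t} {ν} ℓ≤m t≤m ∣E∣≤ν = begin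
    ℓ Cℚ t * c²
      ≤⟨ *-monoʳ-≤-0≤ (square-nonNeg (coeff t)) (ℕ→ℚ-mono-≤ (C-monoˡ-≤ t ℓ≤m)) ⟩
    m Cℚ t * c²
      ≡⟨ *-identityˡ (m Cℚ t * c²) ⟨
    1ℚ * (m Cℚ t * c²)
      ≤⟨ *-monoʳ-≤-0≤ (levelWeight-nonNeg m t) (ℕ→ℚ-mono-≤ (C-pos t≤m)) ⟩
    m Cℚ t * (m Cℚ t * c²)
      ≡⟨ square-of-product (m Cℚ t) (coeff t) ⟩
    (m Cℚ t * coeff t) * (m Cℚ t * coeff t)
      ≡⟨ cong (λ e → e * e) (EKravchuk-as-coeff t≤m) ⟨
    EKravchuk m A t * EKravchuk m A t
      ≤⟨ ∣p∣≤q⇒p*p≤q*q ∣E∣≤ν ⟩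
    ν * ν ∎
    where
    open ≤-Reasoning
    c² = coeff t * coeff t
    square-of-product : ∀ a c → a * (a * (c * c)) ≡ (a * c) * (a * c)
    square-of-product = solve-∀ ℚ-ring

  levelWeight-high : ∀ {ℓ k t} → ℓ ℕ.≤ m → 1 ℕ.≤ m → k ℕ.< t →
    levelWeight ℓ t ≤ (ℕ→ℚ ℓ ÷ℕ m) ^ℚ suc k * levelWeight m t
  levelWeight-high {ℓ} {k} {t} ℓ≤m 1≤m k<t = begin
    ℓ Cℚ t * c²
      ≤⟨ *-monoʳ-≤-0≤ (square-nonNeg (coeff t)) (Cℚ-ratio-bound t ℓ≤m 1≤m) ⟩
    r ^ℚ t * m Cℚ t * c²
      ≤⟨ *-monoʳ-≤-0≤ (square-nonNeg (coeff t)) (*-monoʳ-≤-0≤ (ℕ→ℚ-nonNeg (m C t)) r^t≤r^[1+k]) ⟩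
    r ^ℚ suc k * m Cℚ t * c²
      ≡⟨ *-assoc (r ^ℚ suc k) (m Cℚ t) c² ⟩
    r ^ℚ suc k * levelWeight m t ∎
    where
    open ≤-Reasoning
    r = ℕ→ℚ ℓ ÷ℕ m
    c² = coeff t * coeff t
    r^t≤r^[1+k] : r ^ℚ t ≤ r ^ℚ suc k
    r^t≤r^[1+k] = subst (λ s → r ^ℚ s ≤ r ^ℚ suc k) (ℕₚ.m+[n∸m]≡n k<t)
      (^ℚ-antimono (0≤ℓ÷ℕm ℓ m) (ℓ÷ℕm≤1 ℓ≤m 1≤m) (suc k) (t ∸ suc k))

open import Defs
open import Data.Nat using (ℕ; suc; _≤_)
open import Data.Rational using (ℚ; _+_; _*_; 0ℚ; ∣_∣) renaming (_≤_ to _≤ℚ_; _<_ to _<ℚ_)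
open import Data.Fin.Subset using (Subset; _∩_; ∣_∣)
open import Relation.Binary.PropositionalEquality using (_≡_)
open import Data.Nat using (z≤n; s≤s)
open import Data.Nat.Properties using (≤-trans)
open import Data.Fin.Subset.Properties using (∣p∩q∣≤∣p∣)
open import Data.Product using (_,_)
open import Data.Rational.Properties using (module ≤-Reasoning; 0≤p⇒∣p∣≡p)
open import Relation.Binary.PropositionalEquality using (cong; subst; sym)
open RationalArithmetic using (^ℚ-nonNeg; 0≤ℓ÷ℕm)
open FiniteSums using (∑; ∑-nonNeg; ∑-split-bound)

lemma3p8 : (k m M : ℕ) → 1 ≤ k → k ≤ m → m ≤ M →
    (ν : ℚ) → 0ℚ <ℚ ν →
    (A : ℕ → ℚ) → IsDistribution m A →
    (∀ t → 1 ≤ t → t ≤ k → Data.Rational.∣ EKravchuk m A t ∣ ≤ℚ ν) →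
    (S S′ : Subset M) → Data.Fin.Subset.∣ S ∣ ≡ m → Data.Fin.Subset.∣ S′ ∣ ≡ m →
    Data.Rational.∣ chiU M (P M m A S) (P M m A S′) ∣
    ≤ℚ ((ℕ→ℚ Data.Fin.Subset.∣ S ∩ S′ ∣ ÷ℕ m) ^ℚ suc k) * chiSqBin m A
    + ℕ→ℚ k * (ν * ν)
lemma3p8 k m M 1≤k k≤m _ ν _ A (_ , ΣA≡1) ∣E∣≤ν S S′ ∣S∣≡m ∣S′∣≡m = begin
  Data.Rational.∣ chiU M (P M m A S) (P M m A S′) ∣
    ≡⟨ cong Data.Rational.∣_∣ (chiU-as-∑ S S′ ∣S∣≡m ∣S′∣≡m ΣA≡1) ⟩
  Data.Rational.∣ ∑[ t < m ] levelWeight ℓ (suc t) ∣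
    ≡⟨ 0≤p⇒∣p∣≡p (∑-nonNeg m (λ t → levelWeight-nonNeg ℓ (suc t))) ⟩
  ∑[ t < m ] levelWeight ℓ (suc t)
    ≤⟨ ∑-split-bound k≤m (^ℚ-nonNeg (suc k) (0≤ℓ÷ℕm ℓ m)) (λ t → levelWeight-nonNeg m (suc t)) low high ⟩
  ρ * ∑[ t < m ] levelWeight m (suc t) + ℕ→ℚ k * (ν * ν)
    ≡⟨ cong (λ χ² → ρ * χ² + ℕ→ℚ k * (ν * ν)) (sym (chiSqBin-as-∑ ΣA≡1)) ⟩
  ρ * chiSqBin m A + ℕ→ℚ k * (ν * ν) ∎
  where
  open ≤-Reasoning
  open PlantedDistribution m A
  ℓ = Data.Fin.Subset.∣ S ∩ S′ ∣
  ρ = (ℕ→ℚ ℓ ÷ℕ m) ^ℚ suc k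
  ℓ≤m : ℓ ≤ m
  ℓ≤m = subst (ℓ ≤_) ∣S∣≡m (∣p∩q∣≤∣p∣ S S′)
  low : ∀ t → suc t ≤ k → levelWeight ℓ (suc t) ≤ℚ ν * ν
  low t 1+t≤k = levelWeight-low ℓ≤m (≤-trans 1+t≤k k≤m) (∣E∣≤ν (suc t) (s≤s z≤n) 1+t≤k)
  high : ∀ t → k ≤ t → levelWeight ℓ (suc t) ≤ℚ ρ * levelWeight m (suc t)
  high t k≤t = levelWeight-high ℓ≤m (≤-trans 1≤k k≤m) (s≤s k≤t)
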